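{- Let $G$ be a stop parity game with arena $(V=V_\mathrm{E}\uplus V_\mathrm{O},E)$, ranking $rank:V\to\mathbb{N}$ and player-aware coloring $\lambda:V\to C_\mathrm{E}\uplus C_\mathrm{O}$. The following hold. 1. For enforcements $P,P',Q,Q'$ with $P'\sqsubseteq P$ and $Q'\sqsubseteq Q$ and any color $c$: $\mathrm{Merge}(P',c,Q')\sqsubseteq \mathrm{Merge}(P,c,Q)$. 2. Let $c\in C_\mathrm{O}$, let $\rho_\mathrm{E}$ be a strategy safe from $v$ in $G$ and $\rho'_\mathrm{E}$ a strategy safe from every vertex of color $c$ in $G$. Let $\rho''_\mathrm{E}$ behave like $\rho_\mathrm{E}$, but when the play reaches a vertex of color $c$, $\rho''_\mathrm{E}$ forgets the past and switches permanently to the behaviour of $\rho'_\mathrm{E}$. Then $\rho''_\mathrm{E}$ is safe from $v$ in $G$ and \[\mathrm{Enf}_{\rho''_\mathrm{E}}(v)\sqsubseteq \mathrm{Merge}\big(\mathrm{Enf}_{\rho_\mathrm{E}}(v),\,c,\,\mathrm{Union}(\mathrm{Enf}_{\rho'_\mathrm{E}}(w_1),\ldots,\mathrm{Enf}_{\rho'_\mathrm{E}}(w_m))\big),\] where $w_1,\dots,w_m$ are all vertices of color $c$ and $\mathrm{Union}(A,B,C)=\mathrm{Union}(\mathrm{Union}(A,B),C)$ etc. 3. Let $\rho_\mathrm{E},\rho'_\mathrm{E}$ be strategies safe from $v$ and from $w$ in $G$ respectively, and let $c\in C_\mathrm{E}$ be such that from every vertex of color $c$ there is an edge to $w$. Let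 $\rho''_\mathrm{E}$ behave like $\rho_\mathrm{E}$, but when $\rho_\mathrm{E}$ decides to play ${STOP}$ at a vertex of color $c$, $\rho''_\mathrm{E}$ moves to $w$ instead, forgets the past and switches permanently to the behaviour of $\rho'_\mathrm{E}$. Then $\rho''_\mathrm{E}$ is safe from $v$ in $G$ and $\mathrm{Enf}_{\rho''_\mathrm{E}}(v)=\mathrm{Merge}(\mathrm{Enf}_{\rho_\mathrm{E}}(v),c,\mathrm{Enf}_{\rho'_\mathrm{E}}(w))$. 4. Let $\rho_\mathrm{E}$ be safe from $v$ in $G$, and let $c\in C_\mathrm{E}$ be such that from every vertex of color $c$ there is an edge to $v$. Let $\rho'_\mathrm{E}$ behave like $\rho_\mathrm{E}$, but each time $\rho_\mathrm{E}$ decides to play ${STOP}$ at a vertex of color $c$, $\rho'_\mathrm{E}$ moves to $v$, forgets the past and resumes as $\rho'_\mathrm{E}$. Then if $\mathrm{Loop}(\mathrm{Enf}_{\rho_\mathrm{E}}(v),c)$ is defined, $\rho'_\mathrm{E}$ is safe from $v$ in $G$ and $\mathrm{Enf}_{\rho'_\mathrm{E}}(v)=\mathrm{Loop}(\mathrm{Enf}_{\rho_\mathrm{E}}(v),c)$.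
   Context: A parity game is played on an arena, a directed graph $(V,E)$ with $V=V_\mathrm{E}\uplus V_\mathrm{O}$, with ranks $rank:V\to\mathbb{N}$. The owner of the current vertex moves a token along an outgoing edge; plays are exhaustive (a move is made whenever possible). Player E wins a play if it is finite and ends at a vertex of $V_\mathrm{O}$, or is infinite and the highest rank occurring infinitely often is even; otherwise O wins. A strategy of player X is a function from (history, current vertex in $V_\mathrm{X}$) to a successor, defined whenever a move is possible; it is positional if it depends only on the current vertex. A stop parity game is a parity game in which player E has at each of his positions an additional move ${STOP}$, which ends the game in a draw. A strategy $\rho_\mathrm{E}$ is safe from $v$ if no play starting at $v$ consistent with $\rho_\mathrm{E}$ is lost by E. A player-aware coloring $\lambda:V\to C_\mathrm{E}\uplus C_\mathrm{O}$ colors vertices of $V_\mathrm{X}$ with colors from $C_\mathrm{X}$. For a finite play prefix $\vec\pi$ let $\mathrm{MaxRank}(\vec\pi)$ be the maximum rank of a vertex on it. Define the total order $\preceq$ on $\mathbb{N}$ by $p\prec q\iff (-1)^pp<(-1)^qq$ (so $\dots\prec5\prec3\prec1\prec0\prec2\prec4\prec\dots$); $\min_\preceq$ of a finite set is its $\preceq$-least element, undefined for the empty set. For a strategy $\rho_\mathrm{E}$ and vertex $v$, let $\mathrm{Pref}(v,w)$ be the set of prefixes ending at $w$ of plays starting at $v$ consistent with $\rho_\mathrm{E}$. Define the partial function $e_v(w)=\min_\preceq\{\mathrm{MaxRank}(\vec\pi):\vec\pi\in\mathrm{Pref}(v,w),\ \rho_\mathrm{E}(\vec\pi)={STOP}\}$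 for $w\in V_\mathrm{E}$ and $e_v(w)=\min_\preceq\{\mathrm{MaxRank}(\vec\pi):\vec\pi\in\mathrm{Pref}(v,w)\}$ for $w\in V_\mathrm{O}$, and the enforcement of $\rho_\mathrm{E}$ from $v$, $\mathrm{Enf}_{\rho_\mathrm{E}}(v)(c)=\min_\preceq\{e_v(w): w\text{ with } e_v(w) \text{ defined and } \lambda(w)=c\}$. An enforcement is any partial function from $C=C_\mathrm{E}\uplus C_\mathrm{O}$ to $\{0,\dots,\max rank(V)\}$. For enforcements: $P\sqsubseteq Q$ iff $\mathrm{Dom}(P)\subseteq\mathrm{Dom}(Q)$ and $Q(a)\preceq P(a)$ for all $a\in\mathrm{Dom}(P)$. $\mathrm{Lift}(Q,r)(c)=\max(Q(c),r)$ (usual max) for $c\in\mathrm{Dom}(Q)$; $\mathrm{Union}(P,Q)(c)=\min_\preceq(P(c),Q(c))$, where if only one is defined it is taken and if neither is defined the result is undefined. $\mathrm{Loop}(P,c)$ is: $P$ if $c\in C_\mathrm{E}$ and $c\notin\mathrm{Dom}(P)$; $P$ with $c$ made undefined if $c\in C_\mathrm{E}$ and $P(c)$ is even; undefined otherwise. $\mathrm{Merge}(P,c,Q)$ is: $\mathrm{Union}(P,\mathrm{Lift}(Q,P(c)))$ if $c\in\mathrm{Dom}(P)$ and $c\in C_\mathrm{O}$; $\mathrm{Union}(P',\mathrm{Lift}(Q,P(c)))$ where $P'$ is $P$ with $c$ made undefined, if $c\in\mathrm{Dom}(P)$ and $c\in C_\mathrm{E}$; $P$ otherwise. -}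

module Defs where

open import Data.Nat as ℕ using (ℕ; zero; suc; _⊔_; _≤_)
open import Data.Integer as ℤ using (ℤ; +_; -_)
open import Data.Fin as Fin using (Fin)
import Data.Fin.Properties as FinP
open import Data.Sum using (_⊎_; inj₁; inj₂)
open import Data.Sum.Properties using (≡-dec)
open import Data.Product using (Σ; _×_; _,_)
open import Data.Bool using (Bool; true; false; not; if_then_else_; _∧_)
open import Data.Maybe using (Maybe; just; nothing)
import Data.Maybe as Maybe
open import Data.List using (List; []; _∷_; _∷ʳ_; foldr; map; upTo; allFin; filter)
open import Relation.Nullary using (¬_; does; yes; no)
open import Relation.Binary.PropositionalEquality using (_≡_; refl)
open import Relation.Binary.Definitions using (DecidableEquality)

data Player : Set where
  E O : Player

isEven : ℕ → Bool
isEven zero    = true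
isEven (suc n) = not (isEven n)

signed : ℕ → ℤ
signed p = if isEven p then + p else - (+ p)

_≼_ : ℕ → ℕ → Set
p ≼ q = signed p ℤ.≤ signed q

min≼ : ℕ → ℕ → ℕ
min≼ p q = if does (signed p ℤ.≤? signed q) then p else q

Color : ℕ → ℕ → Set
Color nE nO = Fin nE ⊎ Fin nO

colOwner : ∀ {nE nO} → Color nE nO → Player
colOwner (inj₁ _) = E
colOwner (inj₂ _) = O

_≟C_ : ∀ {nE nO} → DecidableEquality (Color nE nO)
_≟C_ = ≡-dec FinP._≟_ FinP._≟_

Enforcement : ℕ → ℕ → Set
Enforcement nE nO = Color nE nO → Maybe ℕ

module _ {nE nO : ℕ} where

  _⊑_ : Enforcement nE nO → Enforcement nE nO → Set
  P ⊑ Q = ∀ a r → P a ≡ just r → Σ ℕ λ s → Q a ≡ just s × s ≼ r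

  Lift : Enforcement nE nO → ℕ → Enforcement nE nO
  Lift Q r c = Maybe.map (λ x → x ⊔ r) (Q c)

  min≼? : Maybe ℕ → Maybe ℕ → Maybe ℕ
  min≼? (just p) (just q) = just (min≼ p q)
  min≼? (just p) nothing  = just p
  min≼? nothing  (just q) = just q
  min≼? nothing  nothing  = nothing

  Union : Enforcement nE nO → Enforcement nE nO → Enforcement nE nO
  Union P Q c = min≼? (P c) (Q c)

  UnionList : List (Enforcement nE nO) → Enforcement nE nO
  UnionList = Data.List.foldl Union (λ _ → nothing)

  undefAt : Enforcement nE nO → Color nE nO → Enforcement nE nO
  undefAt P c a = if does (a ≟C c) then nothing else P a

  -- Loop(P,c); `nothing` = undefined
  Loop : Enforcement nE nO → Color nE nO → Maybe (Enforcement nE nO)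
  Loop P (inj₂ _) = nothing
  Loop P (inj₁ c) with P (inj₁ c)
  ... | nothing = just P
  ... | just r  = if isEven r then just (undefAt P (inj₁ c)) else nothing

  Merge : Enforcement nE nO → Color nE nO → Enforcement nE nO → Enforcement nE nO
  Merge P c Q with P c
  ... | nothing = P
  Merge P (inj₂ c) Q | just r = Union P (Lift Q r)
  Merge P (inj₁ c) Q | just r = Union (undefAt P (inj₁ c)) (Lift Q r)

record StopParityGame : Set₁ where
  field
    n           : ℕ
    owner       : Fin n → Player
    Edge        : Fin n → Fin n → Set
    rank        : Fin n → ℕ
    nE nO       : ℕ
    col         : Fin n → Color nE nO
    playerAware : ∀ v → colOwner (col v) ≡ owner v

  V : Set
  V = Fin n

  maxRank : ℕ
  maxRank = foldr (λ v m → rank v ⊔ m) 0 (allFin n)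

module Game (G : StopParityGame) where
  open StopParityGame G public

  data Move (u : V) : Set where
    stop : Move u
    go   : (w : V) → Edge u w → Move u

  target : ∀ {u} → Move u → Maybe V
  target stop     = nothing
  target (go w _) = just w

  -- strategy of E: (history before the current vertex, chronological) → current vertex → move.
  -- Values at O-vertices are irrelevant.
  Strategy : Set
  Strategy = List V → (u : V) → Move u

  -- Reach ρ v h w : h ++ [w] is a prefix of a play from v consistent with ρ
  data Reach (ρ : Strategy) (v : V) : List V → V → Set where
    start : Reach ρ v [] v
    stepE : ∀ {h u w} → Reach ρ v h u → owner u ≡ E → target (ρ h u) ≡ just w
          → Reach ρ v (h ∷ʳ u) w
    stepO : ∀ {h u w} → Reach ρ v h u → owner u ≡ O → Edge u w
          → Reach ρ v (h ∷ʳ u) w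

  MaxRank : List V → ℕ
  MaxRank = foldr (λ u m → rank u ⊔ m) 0

  IsMin≼ : (ℕ → Set) → Maybe ℕ → Set
  IsMin≼ S nothing  = ∀ r → ¬ S r
  IsMin≼ S (just r) = S r × (∀ s → S s → r ≼ s)

  -- values MaxRank(π) for π ∈ Pref(v,w) (with ρ(π) = STOP if w ∈ V_E)
  Cand : Strategy → V → V → ℕ → Set
  Cand ρ v w r = Σ (List V) λ h → Reach ρ v h w × (owner w ≡ E → ρ h w ≡ stop)
                                   × MaxRank (h ∷ʳ w) ≡ r

  IsE : Strategy → V → V → Maybe ℕ → Set
  IsE ρ v w m = IsMin≼ (Cand ρ v w) m

  IsEnf : Strategy → V → Enforcement nE nO → Set
  IsEnf ρ v P = ∀ c → IsMin≼ (λ r → Σ V λ w → col w ≡ c × IsE ρ v w (just r)) (P c)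

  Bounded : Enforcement nE nO → Set
  Bounded P = ∀ c r → P c ≡ just r → r ≤ maxRank

  hist : (ℕ → V) → ℕ → List V
  hist p i = map p (upTo i)

  InfPlay : Strategy → V → (ℕ → V) → Set
  InfPlay ρ v p = p 0 ≡ v ×
    (∀ i → (owner (p i) ≡ E → target (ρ (hist p i) (p i)) ≡ just (p (suc i)))
         × (owner (p i) ≡ O → Edge (p i) (p (suc i))))

  Lost : (ℕ → V) → Set
  Lost p = Σ ℕ λ r → isEven r ≡ false
         × (∀ N → Σ ℕ λ i → N ≤ i × rank (p i) ≡ r)
         × (Σ ℕ λ N → ∀ i → N ≤ i → rank (p i) ≤ r)

  -- finite plays end with STOP (draw) or at a dead end of O (won by E),
  -- so only infinite plays can be lost by E
  Safe : Strategy → V → Set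
  Safe ρ v = ∀ p → InfPlay ρ v p → ¬ Lost p

  colorClass : Color nE nO → List V
  colorClass c = filter (λ u → col u ≟C c) (allFin n)

  isStop : ∀ {u} → Move u → Bool
  isStop stop     = true
  isStop (go _ _) = false

  -- part 2: play ρ until a vertex of color c is reached, then forget the
  -- past and play ρ' (history starting at that vertex)
  suffixFrom : Color nE nO → List V → Maybe (List V)
  suffixFrom c [] = nothing
  suffixFrom c (x ∷ xs) = if does (col x ≟C c) then just (x ∷ xs) else suffixFrom c xs

  switchOnColor : Color nE nO → Strategy → Strategy → Strategy
  switchOnColor c ρ ρ' h u with suffixFrom c h
  ... | just s  = ρ' s u
  ... | nothing = if does (col u ≟C c) then ρ' [] u else ρ h u

  -- part 3: play ρ; when ρ plays STOP at a vertex of color c, move to w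
  -- and then play ρ' (history starting at w)
  findStop : Color nE nO → Strategy → List V → List V → Maybe (List V)
  findStop c ρ acc [] = nothing
  findStop c ρ acc (x ∷ xs) =
    if does (col x ≟C c) ∧ isStop (ρ acc x) then just xs else findStop c ρ (acc ∷ʳ x) xs

  redirectStop : (c : Color nE nO) (w : V) → (∀ u → col u ≡ c → Edge u w)
               → Strategy → Strategy → Strategy
  redirectStop c w e ρ ρ' h u with findStop c ρ [] h
  ... | just s = ρ' s u
  ... | nothing with col u ≟C c | ρ h u
  ...   | yes cu | stop = go w (e u cu)
  ...   | _      | m    = m

  -- part 4: play ρ; each time ρ plays STOP at a vertex of color c, move to v
  -- and restart (history starting at v)
  segment : Color nE nO → Strategy → List V → List V → List V
  segment c ρ acc [] = acc
  segment c ρ acc (x ∷ xs) =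
    if does (col x ≟C c) ∧ isStop (ρ acc x) then segment c ρ [] xs else segment c ρ (acc ∷ʳ x) xs

  loopStop : (c : Color nE nO) (v : V) → (∀ u → col u ≡ c → Edge u v)
           → Strategy → Strategy
  loopStop c v e ρ h u with segment c ρ [] h
  ... | a with col u ≟C c | ρ a u
  ...   | yes cu | stop = go v (e u cu)
  ...   | _      | m    = m

-- Part 1 holds because ⊔ is monotone for the parity order ≼.  For the combined strategies,
-- a history of the new strategy is a history of ρ, or a history of ρ up to the switch point
-- followed by a history of ρ' (of ρ from v, in part 4) from there; its maximal rank is the
-- maximum of the pieces, and Enf is a ≼-minimum of such maxima, which gives the bounds, and
-- the equalities where the pieces of any two histories can be glued back together.  An
-- infinite play eventually follows one of the strategies, whose safety applies to the suffix,
-- unless in part 4 it returns to v infinitely often; but every return closes a round whose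
-- maximal rank is even because Loop(P, c) is defined, so the rank seen infinitely often,
-- which bounds all late rounds and is the maximum of one of them, is even.

module Submission where

open import Defs
open import Data.Bool using (Bool; true; false; _∧_; if_then_else_)
open import Data.Bool.Properties using (∧-zeroʳ; ¬-not)
open import Data.Empty using (⊥; ⊥-elim)
open import Data.Fin using (Fin)
open import Data.Integer as ℤ using (+≤+; -≤+; -≤-)
import Data.Integer.Properties as ℤₚ
open import Data.List using (List; []; _∷_; _∷ʳ_; _++_; [_]; map; foldl; upTo)
import Data.List.Properties as Listₚ
import Data.List.Membership.Propositional.Properties as ∈ₚ
open import Data.List.Membership.Propositional using (_∈_)
open import Data.List.Relation.Unary.All using (All; []; _∷_; lookup)
open import Data.List.Relation.Unary.Any using (here; there)
open import Data.Maybe using (Maybe; just; nothing)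
open import Data.Nat using (ℕ; zero; suc; _⊔_; _≤_; _<_; _+_; z≤n; s≤s)
import Data.Nat.Properties as ℕₚ
open import Data.Product using (Σ; _×_; _,_; proj₁; proj₂; uncurry)
open import Data.Sum using (_⊎_; inj₁; inj₂)
open import Relation.Binary.Bundles using (TotalOrder)
import Relation.Binary.Construct.On as On
open import Relation.Binary.PropositionalEquality hiding ([_])
open import Relation.Nullary using (¬_; Dec; does; yes; no)
open import Relation.Nullary.Negation using (DoubleNegation)
open import Relation.Nullary.Decidable using (¬¬-excluded-middle)
open import Function using (case_of_; id)

≼-totalOrder : TotalOrder _ _ _
≼-totalOrder = On.totalOrder ℤₚ.≤-totalOrder signed

-- p ≼ q unfolds to signed p ℤ.≤ signed q, from which p and q cannot be inferred; hence
-- reflexivity and transitivity are taken from ℤ, and elsewhere the numbers are passed explicitly.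
open ℤₚ using () renaming (≤-refl to ≼-refl; ≤-trans to ≼-trans)

≼-reflexive : ∀ {p q} → p ≡ q → p ≼ q
≼-reflexive refl = ≼-refl

≼-total : ∀ p q → p ≼ q ⊎ q ≼ p
≼-total p q = ℤₚ.≤-total (signed p) (signed q)

_≼?_ : ∀ p q → Dec (p ≼ q)
p ≼? q = signed p ℤ.≤? signed q

even≼even : ∀ {p q} → isEven p ≡ true → isEven q ≡ true → p ≤ q → p ≼ q
even≼even {p} {q} ep eq p≤q rewrite ep | eq = +≤+ p≤q

odd≼even : ∀ {p q} → isEven p ≡ false → isEven q ≡ true → p ≼ q
odd≼even {suc p} {q} ep eq rewrite ep | eq = -≤+

odd≼odd : ∀ {p q} → isEven p ≡ false → isEven q ≡ false → q ≤ p → p ≼ q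
odd≼odd {suc p} {suc q} ep eq (s≤s q≤p) rewrite ep | eq = -≤- q≤p

parity : ∀ p → isEven p ≡ true ⊎ isEven p ≡ false
parity p with isEven p
... | true  = inj₁ refl
... | false = inj₂ refl

even≼⇒ : ∀ {p q} → isEven p ≡ true → p ≼ q → isEven q ≡ true × p ≤ q
even≼⇒ {p} {q} ep p≼q with parity q
... | inj₁ eq rewrite ep | eq with p≼q
...   | +≤+ p≤q = refl , p≤q
even≼⇒ {p} {suc q} ep p≼q | inj₂ eq rewrite ep | eq with p≼q
... | ()

≼odd⇒ : ∀ {p q} → isEven q ≡ false → p ≼ q → isEven p ≡ false × q ≤ p
≼odd⇒ {p} {suc q} eq p≼q with parity p
... | inj₁ ep rewrite ep | eq with p≼q
...   | ()
≼odd⇒ {suc p} {suc q} eq p≼q | inj₂ ep rewrite ep | eq with p≼q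
... | -≤- q≤p = refl , s≤s q≤p

between-≼ʳ : ∀ {a a' b} → a ≼ a' → a ≤ b → b ≤ a' → b ≼ a'
between-≼ʳ {a} {a'} {b} a≼a' a≤b b≤a' with parity a' | parity b
... | inj₁ ea' | inj₁ eb = even≼even eb ea' b≤a'
... | inj₁ ea' | inj₂ ob = odd≼even {b} {a'} ob ea'
... | inj₂ oa' | _ =
  ≼-reflexive (ℕₚ.≤-antisym b≤a' (ℕₚ.≤-trans (proj₂ (≼odd⇒ {a} {a'} oa' a≼a')) a≤b))

between-≼ˡ : ∀ {a a' b} → a ≼ a' → a' ≤ b → b ≤ a → a ≼ b
between-≼ˡ {a} {a'} {b} a≼a' a'≤b b≤a with parity a | parity b
... | inj₁ ea | _ =
  ≼-reflexive (ℕₚ.≤-antisym (ℕₚ.≤-trans (proj₂ (even≼⇒ {a} {a'} ea a≼a')) a'≤b) b≤a)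
... | inj₂ oa | inj₁ eb = odd≼even {a} {b} oa eb
... | inj₂ oa | inj₂ ob = odd≼odd {a} {b} oa ob b≤a

⊔-monoˡ-≼ : ∀ {a a'} b → a ≼ a' → (a ⊔ b) ≼ (a' ⊔ b)
⊔-monoˡ-≼ {a} {a'} b a≼a' with ℕₚ.≤-total a b | ℕₚ.≤-total a' b
... | inj₁ a≤b | inj₁ a'≤b rewrite ℕₚ.m≤n⇒m⊔n≡n a≤b | ℕₚ.m≤n⇒m⊔n≡n a'≤b = ≼-refl
... | inj₂ b≤a | inj₂ b≤a' rewrite ℕₚ.m≥n⇒m⊔n≡m b≤a | ℕₚ.m≥n⇒m⊔n≡m b≤a' = a≼a'
... | inj₁ a≤b | inj₂ b≤a' rewrite ℕₚ.m≤n⇒m⊔n≡n a≤b | ℕₚ.m≥n⇒m⊔n≡m b≤a' =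
  between-≼ʳ {a} a≼a' a≤b b≤a'
... | inj₂ b≤a | inj₁ a'≤b rewrite ℕₚ.m≥n⇒m⊔n≡m b≤a | ℕₚ.m≤n⇒m⊔n≡n a'≤b =
  between-≼ˡ {a} a≼a' a'≤b b≤a

⊔-mono-≼ : ∀ {a a' b b'} → a ≼ a' → b ≼ b' → (a ⊔ b) ≼ (a' ⊔ b')
⊔-mono-≼ {a} {a'} {b} {b'} a≼a' b≼b' =
  ≼-trans (⊔-monoˡ-≼ {a} {a'} b a≼a')
    (subst₂ _≼_ (ℕₚ.⊔-comm b a') (ℕₚ.⊔-comm b' a') (⊔-monoˡ-≼ {b} {b'} a' b≼b'))

⊔-even : ∀ {a b} → isEven a ≡ true → isEven b ≡ true → isEven (a ⊔ b) ≡ true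
⊔-even {a} {b} ea eb with ℕₚ.⊔-sel a b
... | inj₁ eq rewrite eq = ea
... | inj₂ eq rewrite eq = eb

≼even⊔ : ∀ a {b} → isEven b ≡ true → a ≼ (b ⊔ a)
≼even⊔ a {b} eb with ℕₚ.≤-total b a
... | inj₁ b≤a rewrite ℕₚ.m≤n⇒m⊔n≡n b≤a = ≼-refl
... | inj₂ a≤b rewrite ℕₚ.m≥n⇒m⊔n≡m a≤b with parity a
...   | inj₁ ea = even≼even ea eb a≤b
...   | inj₂ oa = odd≼even {a} {b} oa eb

min≼-≼ˡ : ∀ p q → min≼ p q ≼ p
min≼-≼ˡ p q with p ≼? q
... | yes _   = ≼-refl
... | no p⋠q with ≼-total p q
...   | inj₁ p≼q = ⊥-elim (p⋠q p≼q)
...   | inj₂ q≼p = q≼p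

min≼-≼ʳ : ∀ p q → min≼ p q ≼ q
min≼-≼ʳ p q with p ≼? q
... | yes p≼q = p≼q
... | no _    = ≼-refl

min≼-sel : ∀ p q → min≼ p q ≡ p ⊎ min≼ p q ≡ q
min≼-sel p q with p ≼? q
... | yes _ = inj₁ refl
... | no _  = inj₂ refl

min≼-greatest : ∀ {p q r} → r ≼ p → r ≼ q → r ≼ min≼ p q
min≼-greatest {p} {q} r≼p r≼q with min≼-sel p q
... | inj₁ eq rewrite eq = r≼p
... | inj₂ eq rewrite eq = r≼q

last-true : (b : ℕ → Bool) (M : ℕ) → (∀ j → M ≤ j → b j ≡ false) →
            (∀ j → b j ≡ false) ⊎ Σ ℕ λ j → b j ≡ true × (∀ k → j < k → b k ≡ false)
last-true b zero    none = inj₁ λ j → none j z≤n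
last-true b (suc M) none with b M in bM
... | true  = inj₂ (M , bM , none)
... | false = last-true b M λ j M≤j → case ℕₚ.m≤n⇒m<n∨m≡n M≤j of λ where
  (inj₁ M<j)  → none j M<j
  (inj₂ refl) → bM

module _ (S : ℕ → Set) where

  enumerate-below : ∀ N → DoubleNegation (Σ (List ℕ) λ xs → All S xs × (∀ {r} → S r → r < N → r ∈ xs))
  enumerate-below zero    k = k ([] , [] , λ _ ())
  enumerate-below (suc N) k = enumerate-below N λ (xs , all , complete) → ¬¬-excluded-middle λ where
    (yes SN) → k (N ∷ xs , SN ∷ all , λ Sr r<1+N → case ℕₚ.m<1+n⇒m<n∨m≡n r<1+N of λ where
                   (inj₁ r<N) → there (complete Sr r<N)
                   (inj₂ refl) → here refl)
    (no ¬SN) → k (xs , all , λ Sr r<1+N → case ℕₚ.m<1+n⇒m<n∨m≡n r<1+N of λ where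
                   (inj₁ r<N) → complete Sr r<N
                   (inj₂ refl) → ⊥-elim (¬SN Sr))

  open import Data.List.Extrema ≼-totalOrder using (min; min≤⊤; min≤xs; argmin-all)

  ≼-minimum : ∀ N → (∀ {r} → S r → r < N) → ∀ {r₀} → S r₀ →
              DoubleNegation (Σ ℕ λ t → (S t × (∀ s → S s → t ≼ s)) × t ≼ r₀)
  ≼-minimum N bound {r₀} Sr₀ k = enumerate-below N λ (xs , all , complete) →
    k (min r₀ xs , (argmin-all id Sr₀ all , λ s Ss → lookup (min≤xs r₀ xs) (complete Ss (bound Ss))) ,
       min≤⊤ r₀ xs)

_⊑ᵐ_ : Maybe ℕ → Maybe ℕ → Set
x ⊑ᵐ y = ∀ r → x ≡ just r → Σ ℕ λ s → y ≡ just s × s ≼ r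

module _ {nE nO : ℕ} where

  ⊑-refl : {P : Enforcement nE nO} → P ⊑ P
  ⊑-refl a r eq = r , eq , ≼-refl

  ⊑-trans : {P Q R : Enforcement nE nO} → P ⊑ Q → Q ⊑ R → P ⊑ R
  ⊑-trans P⊑Q Q⊑R a r eq with P⊑Q a r eq
  ... | s , eq' , s≼r with Q⊑R a s eq'
  ...   | t , eq'' , t≼s = t , eq'' , ≼-trans t≼s s≼r

  Union-upperˡ : (P Q : Enforcement nE nO) → P ⊑ Union P Q
  Union-upperˡ P Q a r eq with P a | Q a
  Union-upperˡ P Q a r refl | just p | just q  = min≼ p q , refl , min≼-≼ˡ p q
  Union-upperˡ P Q a r refl | just p | nothing = p , refl , ≼-refl

  Union-upperʳ : (P Q : Enforcement nE nO) → Q ⊑ Union P Q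
  Union-upperʳ P Q a r eq with P a | Q a
  Union-upperʳ P Q a r refl | just p  | just q = min≼ p q , refl , min≼-≼ʳ p q
  Union-upperʳ P Q a r refl | nothing | just q = q , refl , ≼-refl

  Union-mono : {P P' Q Q' : Enforcement nE nO} → P' ⊑ P → Q' ⊑ Q → Union P' Q' ⊑ Union P Q
  Union-mono {P} {P'} {Q} {Q'} P'⊑P Q'⊑Q a = pointwise (P' a) (Q' a) refl refl
    where
    pointwise : ∀ x' y' → P' a ≡ x' → Q' a ≡ y' → min≼? {nE} {nO} x' y' ⊑ᵐ Union P Q a
    pointwise (just p') nothing eqP _ r refl = ⊑-trans P'⊑P (Union-upperˡ P Q) a r eqP
    pointwise nothing (just q') _ eqQ r refl = ⊑-trans Q'⊑Q (Union-upperʳ P Q) a r eqQ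
    pointwise (just p') (just q') eqP eqQ r refl with P'⊑P a p' eqP | Q'⊑Q a q' eqQ
    ... | p , eqp , p≼p' | q , eqq , q≼q' rewrite eqp | eqq =
      min≼ p q , refl ,
      min≼-greatest {p'} {q'} {min≼ p q} (≼-trans (min≼-≼ˡ p q) p≼p') (≼-trans (min≼-≼ʳ p q) q≼q')

  Union-sel : (P Q : Enforcement nE nO) {a : Color nE nO} {t : ℕ} →
              Union P Q a ≡ just t → P a ≡ just t ⊎ Q a ≡ just t
  Union-sel P Q {a} eq with P a | Q a
  ... | just p  | nothing = inj₁ eq
  ... | nothing | just q  = inj₂ eq
  ... | just p  | just q with min≼-sel p q
  ...   | inj₁ m≡p = inj₁ (trans (cong just (sym m≡p)) eq)
  ...   | inj₂ m≡q = inj₂ (trans (cong just (sym m≡q)) eq)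

  Lift-mono : {Q Q' : Enforcement nE nO} {r r' : ℕ} → r ≼ r' → Q' ⊑ Q → Lift Q' r' ⊑ Lift Q r
  Lift-mono {Q} {Q'} {r} {r'} r≼r' Q'⊑Q a t eq with Q' a in eqQ'
  Lift-mono {Q} {Q'} {r} {r'} r≼r' Q'⊑Q a _ refl | just q' with Q'⊑Q a q' eqQ'
  ... | q , eqQ , q≼q' rewrite eqQ = q ⊔ r , refl , ⊔-mono-≼ {q} {q'} {r} {r'} q≼q' r≼r'

  Lift-just : (Q : Enforcement nE nO) (r : ℕ) {a : Color nE nO} {q : ℕ} →
              Q a ≡ just q → Lift Q r a ≡ just (q ⊔ r)
  Lift-just Q r eq rewrite eq = refl

  Lift-just⁻ : (Q : Enforcement nE nO) (r : ℕ) {a : Color nE nO} {t : ℕ} →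
               Lift Q r a ≡ just t → Σ ℕ λ q → Q a ≡ just q × t ≡ q ⊔ r
  Lift-just⁻ Q r {a} eq with Q a
  Lift-just⁻ Q r {a} refl | just q = q , refl , refl

  undefAt-≢ : (P : Enforcement nE nO) {c a : Color nE nO} → ¬ a ≡ c → undefAt P c a ≡ P a
  undefAt-≢ P {c} {a} a≢c with a ≟C c
  ... | yes a≡c = ⊥-elim (a≢c a≡c)
  ... | no _    = refl

  undefAt-self : (P : Enforcement nE nO) (c : Color nE nO) → undefAt P c c ≡ nothing
  undefAt-self P c with c ≟C c
  ... | yes _   = refl
  ... | no c≢c = ⊥-elim (c≢c refl)

  undefAt-just⁻ : (P : Enforcement nE nO) {c a : Color nE nO} {t : ℕ} →
                  undefAt P c a ≡ just t → ¬ a ≡ c × P a ≡ just t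
  undefAt-just⁻ P {c} {a} eq with a ≟C c
  ... | no a≢c = a≢c , eq

  undefAt-mono : {P P' : Enforcement nE nO} (c : Color nE nO) → P' ⊑ P → undefAt P' c ⊑ undefAt P c
  undefAt-mono c P'⊑P a with a ≟C c
  ... | yes _ = λ _ ()
  ... | no _  = P'⊑P a

  ⊑-foldl-Union : (A : Enforcement nE nO) (As : List (Enforcement nE nO)) → A ⊑ foldl Union A As
  ⊑-foldl-Union A []       = ⊑-refl
  ⊑-foldl-Union A (B ∷ As) = ⊑-trans (Union-upperˡ A B) (⊑-foldl-Union (Union A B) As)

  ∈⇒⊑-foldl-Union : (A : Enforcement nE nO) {B : Enforcement nE nO} {As : List (Enforcement nE nO)} →
                    B ∈ As → B ⊑ foldl Union A As
  ∈⇒⊑-foldl-Union A {As = B ∷ As} (here refl) = ⊑-trans (Union-upperʳ A B) (⊑-foldl-Union (Union A B) As)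
  ∈⇒⊑-foldl-Union A {As = _ ∷ As} (there B∈As) = ∈⇒⊑-foldl-Union _ B∈As

  ∈⇒⊑-UnionList : {B : Enforcement nE nO} {As : List (Enforcement nE nO)} → B ∈ As → B ⊑ UnionList As
  ∈⇒⊑-UnionList = ∈⇒⊑-foldl-Union _

  mergeBase : Enforcement nE nO → Color nE nO → Enforcement nE nO
  mergeBase P (inj₁ c) = undefAt P (inj₁ c)
  mergeBase P (inj₂ c) = P

  Merge-undefined : (P : Enforcement nE nO) (c : Color nE nO) (Q : Enforcement nE nO) →
                    P c ≡ nothing → Merge P c Q ≡ P
  Merge-undefined P c Q eq rewrite eq = refl

  Merge-defined : (P : Enforcement nE nO) (c : Color nE nO) (Q : Enforcement nE nO) {r : ℕ} →
                  P c ≡ just r → Merge P c Q ≡ Union (mergeBase P c) (Lift Q r)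
  Merge-defined P (inj₁ c) Q eq rewrite eq = refl
  Merge-defined P (inj₂ c) Q eq rewrite eq = refl

  mergeBase-≢ : (P : Enforcement nE nO) {c a : Color nE nO} → ¬ a ≡ c → mergeBase P c a ≡ P a
  mergeBase-≢ P {inj₁ c} a≢c = undefAt-≢ P a≢c
  mergeBase-≢ P {inj₂ c} a≢c = refl

  mergeBase-mono : {P P' : Enforcement nE nO} (c : Color nE nO) → P' ⊑ P → mergeBase P' c ⊑ mergeBase P c
  mergeBase-mono (inj₁ c) = undefAt-mono (inj₁ c)
  mergeBase-mono (inj₂ c) P'⊑P = P'⊑P

  ⊑-mergeBase : {P P' : Enforcement nE nO} (c : Color nE nO) → P' ⊑ P → P' c ≡ nothing → P' ⊑ mergeBase P c
  ⊑-mergeBase (inj₂ c) P'⊑P _ = P'⊑P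
  ⊑-mergeBase (inj₁ c) P'⊑P P'c≡nothing a with a ≟C inj₁ c
  ... | no _     = P'⊑P a
  ... | yes refl = λ r eq → case trans (sym P'c≡nothing) eq of λ ()

  ⊑-Merge : {P P' : Enforcement nE nO} (c : Color nE nO) (Q : Enforcement nE nO) →
            P' ⊑ P → P' c ≡ nothing → P' ⊑ Merge P c Q
  ⊑-Merge {P} {P'} c Q P'⊑P P'c≡nothing = by-cases (P c) refl
    where
    by-cases : ∀ m → P c ≡ m → P' ⊑ Merge P c Q
    by-cases nothing  eq = subst (P' ⊑_) (sym (Merge-undefined P c Q eq)) P'⊑P
    by-cases (just r) eq = subst (P' ⊑_) (sym (Merge-defined P c Q eq))
      (⊑-trans (⊑-mergeBase c P'⊑P P'c≡nothing) (Union-upperˡ (mergeBase P c) (Lift Q r)))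

  Merge-mono : {P P' Q Q' : Enforcement nE nO} → P' ⊑ P → Q' ⊑ Q → ∀ c → Merge P' c Q' ⊑ Merge P c Q
  Merge-mono {P} {P'} {Q} {Q'} P'⊑P Q'⊑Q c = by-cases (P' c) refl
    where
    by-cases : ∀ m → P' c ≡ m → Merge P' c Q' ⊑ Merge P c Q
    by-cases nothing eq' = subst (_⊑ Merge P c Q) (sym (Merge-undefined P' c Q' eq')) (⊑-Merge c Q P'⊑P eq')
    by-cases (just r') eq' with P'⊑P c r' eq'
    ... | r , eq , r≼r' = subst₂ _⊑_ (sym (Merge-defined P' c Q' eq')) (sym (Merge-defined P c Q eq))
      (Union-mono (mergeBase-mono c P'⊑P) (Lift-mono r≼r' Q'⊑Q))

  Merge-upper : (P : Enforcement nE nO) (c : Color nE nO) (Q : Enforcement nE nO) {a : Color nE nO} →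
                ¬ a ≡ c → P a ⊑ᵐ Merge P c Q a
  Merge-upper P c Q {a} a≢c = by-cases (P c) refl
    where
    by-cases : ∀ m → P c ≡ m → P a ⊑ᵐ Merge P c Q a
    by-cases nothing  eq = subst (λ R → P a ⊑ᵐ R a) (sym (Merge-undefined P c Q eq)) (⊑-refl {P = P} a)
    by-cases (just r) eq = subst (λ R → P a ⊑ᵐ R a) (sym (Merge-defined P c Q eq))
      (subst (_⊑ᵐ Union (mergeBase P c) (Lift Q r) a) (mergeBase-≢ P a≢c)
        (Union-upperˡ (mergeBase P c) (Lift Q r) a))

  Lift⊑Merge : (P : Enforcement nE nO) (c : Color nE nO) (Q : Enforcement nE nO) {r : ℕ} →
               P c ≡ just r → Lift Q r ⊑ Merge P c Q
  Lift⊑Merge P c Q eq =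
    subst (Lift Q _ ⊑_) (sym (Merge-defined P c Q eq)) (Union-upperʳ (mergeBase P c) (Lift Q _))

  Merge-lifted-bound : (P : Enforcement nE nO) (c : Color nE nO) (Q : Enforcement nE nO) {a : Color nE nO}
                       {pc q m n : ℕ} → P c ≡ just pc → pc ≼ m → Q a ≡ just q → q ≼ n →
                       Σ ℕ λ t → Merge P c Q a ≡ just t × t ≼ (m ⊔ n)
  Merge-lifted-bound P c Q {a} {pc} {q} {m} {n} Pc≡pc pc≼m Qa≡q q≼n
    with Lift⊑Merge P c Q Pc≡pc a (q ⊔ pc) (Lift-just Q pc Qa≡q)
  ... | t , Ma≡t , t≼ = t , Ma≡t ,
    ≼-trans t≼ (subst (_≼ (m ⊔ n)) (ℕₚ.⊔-comm pc q) (⊔-mono-≼ {pc} {m} {q} {n} pc≼m q≼n))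

  Loop-≢ : (P : Enforcement nE nO) (c : Fin nE) {L : Enforcement nE nO} → Loop P (inj₁ c) ≡ just L →
           ∀ {a} → ¬ a ≡ inj₁ c → L a ≡ P a
  Loop-≢ P c loop a≢c with P (inj₁ c) | loop
  ... | nothing | refl = refl
  ... | just r  | loop' with isEven r | loop'
  ...   | true | refl = undefAt-≢ P a≢c

  Loop-self : (P : Enforcement nE nO) (c : Fin nE) {L : Enforcement nE nO} → Loop P (inj₁ c) ≡ just L →
              L (inj₁ c) ≡ nothing
  Loop-self P c loop with P (inj₁ c) in eq | loop
  ... | nothing | refl = eq
  ... | just r  | loop' with isEven r | loop'
  ...   | true | refl = undefAt-self P (inj₁ c)

  Loop-even : (P : Enforcement nE nO) (c : Fin nE) {L : Enforcement nE nO} → Loop P (inj₁ c) ≡ just L →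
              ∀ {r} → P (inj₁ c) ≡ just r → isEven r ≡ true
  Loop-even P c loop eq with P (inj₁ c) | loop
  Loop-even P c loop refl | just r | loop' with isEven r | loop'
  ... | true | refl = refl


module _ (G : StopParityGame) where
  open Game G

  subst-target : ∀ {u x} {m m' : Move u} → m ≡ m' → target m ≡ just x → target m' ≡ just x
  subst-target refl moves = moves

  MaxRank-++ : ∀ xs ys → MaxRank (xs ++ ys) ≡ MaxRank xs ⊔ MaxRank ys
  MaxRank-++ []       ys = refl
  MaxRank-++ (x ∷ xs) ys rewrite MaxRank-++ xs ys = sym (ℕₚ.⊔-assoc (rank x) (MaxRank xs) (MaxRank ys))

  MaxRank-∷ʳ : ∀ xs y → MaxRank (xs ∷ʳ y) ≡ MaxRank xs ⊔ rank y
  MaxRank-∷ʳ xs y rewrite MaxRank-++ xs [ y ] = cong (MaxRank xs ⊔_) (ℕₚ.⊔-identityʳ (rank y))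

  MaxRank-∷ʳ-⊔ : ∀ xs ys {t} x → MaxRank xs ≡ t ⊔ MaxRank ys →
                 MaxRank (xs ∷ʳ x) ≡ t ⊔ MaxRank (ys ∷ʳ x)
  MaxRank-∷ʳ-⊔ xs ys {t} x eq = begin
    MaxRank (xs ∷ʳ x)          ≡⟨ MaxRank-∷ʳ xs x ⟩
    MaxRank xs ⊔ rank x        ≡⟨ cong (_⊔ rank x) eq ⟩
    t ⊔ MaxRank ys ⊔ rank x    ≡⟨ ℕₚ.⊔-assoc t (MaxRank ys) (rank x) ⟩
    t ⊔ (MaxRank ys ⊔ rank x)  ≡⟨ cong (t ⊔_) (sym (MaxRank-∷ʳ ys x)) ⟩
    t ⊔ MaxRank (ys ∷ʳ x)      ∎
    where open ≡-Reasoning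

  -- u ends the first piece and starts the second; counting it twice does not change the maximum.
  MaxRank-join : ∀ h u s x {t} → s ∷ʳ x ≡ u ∷ t →
                 MaxRank ((h ++ s) ∷ʳ x) ≡ MaxRank (h ∷ʳ u) ⊔ MaxRank (s ∷ʳ x)
  MaxRank-join h u s x {t} eq = begin
    MaxRank ((h ++ s) ∷ʳ x)                ≡⟨ cong MaxRank (Listₚ.++-assoc h s [ x ]) ⟩
    MaxRank (h ++ (s ∷ʳ x))                ≡⟨ MaxRank-++ h (s ∷ʳ x) ⟩
    MaxRank h ⊔ MaxRank (s ∷ʳ x)           ≡⟨ cong (λ l → MaxRank h ⊔ MaxRank l) eq ⟩
    MaxRank h ⊔ (rank u ⊔ MaxRank t)
      ≡⟨ cong (λ m → MaxRank h ⊔ (m ⊔ MaxRank t)) (sym (ℕₚ.⊔-idem (rank u))) ⟩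
    MaxRank h ⊔ (rank u ⊔ rank u ⊔ MaxRank t)
      ≡⟨ cong (MaxRank h ⊔_) (ℕₚ.⊔-assoc (rank u) (rank u) (MaxRank t)) ⟩
    MaxRank h ⊔ (rank u ⊔ (rank u ⊔ MaxRank t))
      ≡⟨ sym (ℕₚ.⊔-assoc (MaxRank h) (rank u) _) ⟩
    (MaxRank h ⊔ rank u) ⊔ (rank u ⊔ MaxRank t)
      ≡⟨ cong₂ _⊔_ (sym (MaxRank-∷ʳ h u)) (cong MaxRank (sym eq)) ⟩
    MaxRank (h ∷ʳ u) ⊔ MaxRank (s ∷ʳ x)    ∎
    where open ≡-Reasoning

  ∈⇒rank≤MaxRank : ∀ {u xs} → u ∈ xs → rank u ≤ MaxRank xs
  ∈⇒rank≤MaxRank {u} {x ∷ xs} (here refl)  = ℕₚ.m≤m⊔n (rank u) (MaxRank xs)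
  ∈⇒rank≤MaxRank {u} {x ∷ xs} (there u∈xs) =
    ℕₚ.≤-trans (∈⇒rank≤MaxRank u∈xs) (ℕₚ.m≤n⊔m (rank x) (MaxRank xs))

  MaxRank≤maxRank : ∀ xs → MaxRank xs ≤ maxRank
  MaxRank≤maxRank []       = z≤n
  MaxRank≤maxRank (x ∷ xs) = ℕₚ.⊔-lub (∈⇒rank≤MaxRank (∈ₚ.∈-allFin x)) (MaxRank≤maxRank xs)

  hist-suc : ∀ (p : ℕ → V) i → hist p (suc i) ≡ hist p i ∷ʳ p i
  hist-suc p i = trans (cong (map p) (sym (Listₚ.upTo-∷ʳ i))) (Listₚ.map-++ p (upTo i) [ i ])

  shift : ℕ → (ℕ → V) → (ℕ → V)
  shift k p i = p (k + i)

  hist-+ : ∀ (p : ℕ → V) k j → hist p (k + j) ≡ hist p k ++ hist (shift k p) j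
  hist-+ p k zero rewrite ℕₚ.+-identityʳ k = sym (Listₚ.++-identityʳ (hist p k))
  hist-+ p k (suc j) rewrite ℕₚ.+-suc k j | hist-suc p (k + j) | hist-+ p k j | hist-suc (shift k p) j =
    Listₚ.++-assoc (hist p k) (hist (shift k p) j) [ p (k + j) ]

  rank≤MaxRank-hist : ∀ (p : ℕ → V) {k n} → k < n → rank (p k) ≤ MaxRank (hist p n)
  rank≤MaxRank-hist p k<n = ∈⇒rank≤MaxRank (∈ₚ.∈-map⁺ p (∈ₚ.∈-upTo⁺ k<n))

  MaxRank-hist≤ : ∀ (p : ℕ → V) n {r} → (∀ k → k < n → rank (p k) ≤ r) → MaxRank (hist p n) ≤ r
  MaxRank-hist≤ p zero    bounded = z≤n
  MaxRank-hist≤ p (suc n) {r} bounded =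
    subst (_≤ r) (sym (trans (cong MaxRank (hist-suc p n)) (MaxRank-∷ʳ (hist p n) (p n))))
      (ℕₚ.⊔-lub (MaxRank-hist≤ p n λ k k<n → bounded k (ℕₚ.m<n⇒m<1+n k<n)) (bounded n ℕₚ.≤-refl))

  colourE⇒ownerE : ∀ {u c} → col u ≡ inj₁ c → owner u ≡ E
  colourE⇒ownerE {u} eq = trans (sym (playerAware u)) (cong colOwner eq)

  ownerO⇒colour≢E : ∀ {u c} → owner u ≡ O → ¬ col u ≡ inj₁ c
  ownerO⇒colour≢E isO cu≡c = case trans (sym (colourE⇒ownerE cu≡c)) isO of λ ()

  Lost-shift : ∀ p k → Lost p → Lost (shift k p)
  Lost-shift p k (r , odd , often , N , bounded) =
    r , odd , often' , N , λ i N≤i → bounded (k + i) (ℕₚ.≤-trans N≤i (ℕₚ.m≤n+m i k))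
    where
    often' : ∀ M → Σ ℕ λ i → M ≤ i × rank (shift k p i) ≡ r
    often' M with often (k + M)
    ... | i , k+M≤i , rank≡r with ℕₚ.m≤n⇒∃[o]m+o≡n k+M≤i
    ...   | o , refl = M + o , ℕₚ.m≤m+n M o , trans (cong (λ j → rank (p j)) (sym (ℕₚ.+-assoc k M o))) rank≡r

  InfPlay⇒Reach : ∀ {ρ v p} → InfPlay ρ v p → ∀ i → Reach ρ v (hist p i) (p i)
  InfPlay⇒Reach {ρ} {v} {p} (refl , moves) zero = start
  InfPlay⇒Reach {ρ} {v} {p} play@(_ , moves) (suc i) =
    subst (λ h → Reach ρ v h (p (suc i))) (sym (hist-suc p i)) (step (owner (p i)) refl)
    where
    step : ∀ o → owner (p i) ≡ o → Reach ρ v (hist p i ∷ʳ p i) (p (suc i))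
    step E isE = stepE (InfPlay⇒Reach play i) isE (proj₁ (moves i) isE)
    step O isO = stepO (InfPlay⇒Reach play i) isO (proj₂ (moves i) isO)

  -- shift 0 p is p up to η, so k = 0 compares two strategies along the same play.
  InfPlay-shift : ∀ {ρ ρ' v w p} k → InfPlay ρ v p → p k ≡ w →
                  (∀ i → owner (p (k + i)) ≡ E →
                     ρ (hist p (k + i)) (p (k + i)) ≡ ρ' (hist (shift k p) i) (shift k p i)) →
                  InfPlay ρ' w (shift k p)
  InfPlay-shift {ρ} {ρ'} {p = p} k (_ , moves) pk≡w agree =
    trans (cong p (ℕₚ.+-identityʳ k)) pk≡w ,
    λ i → subst (λ j → (owner (p (k + i)) ≡ E → target (ρ' (hist (shift k p) i) (p (k + i))) ≡ just (p j))
                        × (owner (p (k + i)) ≡ O → Edge (p (k + i)) (p j)))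
                (sym (ℕₚ.+-suc k i))
                ((λ isE → subst-target (agree i isE) (proj₁ (moves (k + i)) isE)) ,
                 proj₂ (moves (k + i)))

  Reach-head : ∀ {ρ u s x} → Reach ρ u s x → Σ (List V) λ t → s ∷ʳ x ≡ u ∷ t
  Reach-head start = [] , refl
  Reach-head (stepE {w = x} reach _ _) with Reach-head reach
  ... | t , eq = t ∷ʳ x , cong (_∷ʳ x) eq
  Reach-head (stepO {w = x} reach _ _) with Reach-head reach
  ... | t , eq = t ∷ʳ x , cong (_∷ʳ x) eq

  LowerBound : Strategy → V → Enforcement nE nO → Set
  LowerBound ρ v P = ∀ {w r} → Cand ρ v w r → Σ ℕ λ s → P (col w) ≡ just s × s ≼ r

  Attained : Strategy → V → Enforcement nE nO → Set
  Attained ρ v P = ∀ {c s} → P c ≡ just s → Σ V λ w → col w ≡ c × Cand ρ v w s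

  -- e_v(w) exists only classically (its candidates are bounded by maxRank), which suffices
  -- because every goal it is used for is decidable or a negation.
  e-minimum : ∀ {ρ v w r} → Cand ρ v w r → DoubleNegation (Σ ℕ λ t → IsE ρ v w (just t) × t ≼ r)
  e-minimum {ρ} {v} {w} =
    ≼-minimum (Cand ρ v w) (suc maxRank)
      (λ (h , _ , _ , r≡) → s≤s (subst (_≤ maxRank) r≡ (MaxRank≤maxRank (h ∷ʳ w))))

  IsEnf⇒LowerBound : ∀ {ρ v P} → IsEnf ρ v P → LowerBound ρ v P
  IsEnf⇒LowerBound {P = P} enf {w} {r} cand with P (col w) | enf (col w)
  ... | nothing | none = ⊥-elim (e-minimum cand λ (t , eₜ , _) → none t (w , refl , eₜ))
  ... | just s | (_ , least) with s ≼? r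
  ...   | yes s≼r = s , refl , s≼r
  ...   | no s⋠r  = ⊥-elim (e-minimum cand λ (t , eₜ , t≼r) → s⋠r (≼-trans (least t (w , refl , eₜ)) t≼r))

  IsEnf⇒Attained : ∀ {ρ v P} → IsEnf ρ v P → Attained ρ v P
  IsEnf⇒Attained {P = P} enf {c} {s} eq with P c | enf c
  IsEnf⇒Attained {P = P} enf refl | just s | (w , cw , cand , _) , _ = w , cw , cand

  IsEnf-intro : ∀ {ρ v P} → LowerBound ρ v P → Attained ρ v P → IsEnf ρ v P
  IsEnf-intro {ρ} {v} {P} lower attained c = by-cases (P c) refl
    where
    s≼candidates : ∀ {s} → P c ≡ just s → ∀ {w} → col w ≡ c → ∀ r → Cand ρ v w r → s ≼ r
    s≼candidates eq refl r cand with lower cand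
    ... | _ , eq' , s'≼r with trans (sym eq) eq'
    ...   | refl = s'≼r
    by-cases : ∀ m → P c ≡ m → IsMin≼ (λ r → Σ V λ w → col w ≡ c × IsE ρ v w (just r)) m
    by-cases nothing eq r (w , refl , cand , _) with trans (sym eq) (proj₁ (proj₂ (lower cand)))
    ... | ()
    by-cases (just s) eq with attained eq
    ... | w , cw , cand =
      (w , cw , cand , s≼candidates eq cw) , λ r (w' , cw' , cand' , _) → s≼candidates eq cw' r cand'

  stopsAt : Color nE nO → Strategy → List V → V → Bool
  stopsAt c ρ h u = does (col u ≟C c) ∧ isStop (ρ h u)

  stopsAt-true⁻ : ∀ {c} ρ h {u} → stopsAt c ρ h u ≡ true → col u ≡ c × ρ h u ≡ stop
  stopsAt-true⁻ {c} ρ h {u} eq with col u ≟C c | ρ h u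
  ... | yes cu≡c | stop = cu≡c , refl

  stopsAt-true : ∀ {c} ρ h {u} → col u ≡ c → ρ h u ≡ stop → stopsAt c ρ h u ≡ true
  stopsAt-true {c} ρ h {u} cu≡c ρ≡stop with col u ≟C c
  ... | yes _ rewrite ρ≡stop = refl
  ... | no cu≢c = ⊥-elim (cu≢c cu≡c)

  stopsAt-≢ : ∀ {c} ρ h {u} → ¬ col u ≡ c → stopsAt c ρ h u ≡ false
  stopsAt-≢ {c} ρ h {u} cu≢c with col u ≟C c
  ... | yes cu≡c = ⊥-elim (cu≢c cu≡c)
  ... | no _     = refl

  stopsAt-move : ∀ {c} ρ h {u x} → target (ρ h u) ≡ just x → stopsAt c ρ h u ≡ false
  stopsAt-move {c} ρ h {u} moves with ρ h u
  ... | go _ _ = ∧-zeroʳ (does (col u ≟C c))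

  stopsAt-O : ∀ {c} ρ h {u} → owner u ≡ O → stopsAt (inj₁ c) ρ h u ≡ false
  stopsAt-O ρ h isO = stopsAt-≢ ρ h (ownerO⇒colour≢E isO)

  suffixFrom-++ : ∀ {c} xs ys → suffixFrom c xs ≡ nothing → suffixFrom c (xs ++ ys) ≡ suffixFrom c ys
  suffixFrom-++ []       ys _ = refl
  suffixFrom-++ {c} (x ∷ xs) ys eq with col x ≟C c
  ... | no _ = suffixFrom-++ xs ys eq

  suffixFrom-∷ʳ : ∀ {c} h u → suffixFrom c h ≡ nothing → ¬ col u ≡ c → suffixFrom c (h ∷ʳ u) ≡ nothing
  suffixFrom-∷ʳ {c} h u eq cu≢c rewrite suffixFrom-++ h [ u ] eq with col u ≟C c
  ... | yes cu≡c = ⊥-elim (cu≢c cu≡c)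
  ... | no _     = refl

  suffixFrom-∷ : ∀ {c} u t → col u ≡ c → suffixFrom c (u ∷ t) ≡ just (u ∷ t)
  suffixFrom-∷ {c} u t cu≡c with col u ≟C c
  ... | yes _    = refl
  ... | no cu≢c = ⊥-elim (cu≢c cu≡c)

  module _ {c : Color nE nO} {ρ : Strategy} where

    findStop-++-nothing : ∀ acc xs ys → findStop c ρ acc xs ≡ nothing →
                          findStop c ρ acc (xs ++ ys) ≡ findStop c ρ (acc ++ xs) ys
    findStop-++-nothing acc [] ys _ rewrite Listₚ.++-identityʳ acc = refl
    findStop-++-nothing acc (x ∷ xs) ys eq with stopsAt c ρ acc x
    ... | false rewrite sym (Listₚ.∷ʳ-++ acc x xs) = findStop-++-nothing (acc ∷ʳ x) xs ys eq

    findStop-++-just : ∀ acc xs ys {s} → findStop c ρ acc xs ≡ just s →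
                       findStop c ρ acc (xs ++ ys) ≡ just (s ++ ys)
    findStop-++-just acc (x ∷ xs) ys eq with stopsAt c ρ acc x
    findStop-++-just acc (x ∷ xs) ys refl | true = refl
    ... | false = findStop-++-just (acc ∷ʳ x) xs ys eq

    segment-++ : ∀ acc xs ys → segment c ρ acc (xs ++ ys) ≡ segment c ρ (segment c ρ acc xs) ys
    segment-++ acc []       ys = refl
    segment-++ acc (x ∷ xs) ys with stopsAt c ρ acc x
    ... | true  = segment-++ [] xs ys
    ... | false = segment-++ (acc ∷ʳ x) xs ys

  module SwitchOnColor (c : Color nE nO) (v : V) (ρ ρ' : Strategy) where

    ρ″ : Strategy
    ρ″ = switchOnColor c ρ ρ'

    ρ″-before : ∀ h u → suffixFrom c h ≡ nothing → ¬ col u ≡ c → ρ″ h u ≡ ρ h u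
    ρ″-before h u eq cu≢c with suffixFrom c h
    ρ″-before h u refl cu≢c | nothing with col u ≟C c
    ... | yes cu≡c = ⊥-elim (cu≢c cu≡c)
    ... | no _     = refl

    ρ″-switch : ∀ h u → suffixFrom c h ≡ nothing → col u ≡ c → ρ″ h u ≡ ρ' [] u
    ρ″-switch h u eq cu≡c with suffixFrom c h
    ρ″-switch h u refl cu≡c | nothing with col u ≟C c
    ... | yes _    = refl
    ... | no cu≢c = ⊥-elim (cu≢c cu≡c)

    ρ″-after : ∀ h {s} u → suffixFrom c h ≡ just s → ρ″ h u ≡ ρ' s u
    ρ″-after h u eq with suffixFrom c h
    ρ″-after h u refl | just s = refl

    record Switched (h : List V) (x : V) : Set where
      field
        h₀ : List V
        u₀ : V
        s  : List V
        h≡h₀++s    : h ≡ h₀ ++ s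
        unswitched : suffixFrom c h₀ ≡ nothing
        reach₀     : Reach ρ v h₀ u₀
        colour₀    : col u₀ ≡ c
        reach'     : Reach ρ' u₀ s x
        follows-ρ' : ρ″ h x ≡ ρ' s x

    Phase : List V → V → Set
    Phase h x = (suffixFrom c h ≡ nothing × ¬ col x ≡ c × Reach ρ v h x) ⊎ Switched h x

    enter : ∀ {h x} → suffixFrom c h ≡ nothing → Reach ρ v h x → Phase h x
    enter {h} {x} unswitched reach with col x ≟C c
    ... | no cx≢c = inj₁ (unswitched , cx≢c , reach)
    ... | yes cx≡c = inj₂ record
      { h₀ = h ; u₀ = x ; s = [] ; h≡h₀++s = sym (Listₚ.++-identityʳ h) ; unswitched = unswitched
      ; reach₀ = reach ; colour₀ = cx≡c ; reach' = start ; follows-ρ' = ρ″-switch h x unswitched cx≡c }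

    extend : ∀ {h u x} → (sw : Switched h u) → Reach ρ' (Switched.u₀ sw) (Switched.s sw ∷ʳ u) x →
             Switched (h ∷ʳ u) x
    extend {h} {u} {x} sw reach = record
      { h₀ = h₀ ; u₀ = u₀ ; s = s ∷ʳ u ; h≡h₀++s = h∷ʳu≡ ; unswitched = unswitched
      ; reach₀ = reach₀ ; colour₀ = colour₀ ; reach' = reach
      ; follows-ρ' = ρ″-after (h ∷ʳ u) x (begin
          suffixFrom c (h ∷ʳ u)      ≡⟨ cong (suffixFrom c) h∷ʳu≡ ⟩
          suffixFrom c (h₀ ++ s ∷ʳ u) ≡⟨ suffixFrom-++ {c} h₀ (s ∷ʳ u) unswitched ⟩
          suffixFrom c (s ∷ʳ u)      ≡⟨ cong (suffixFrom c) head ⟩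
          suffixFrom c (u₀ ∷ t)      ≡⟨ suffixFrom-∷ {c} u₀ t colour₀ ⟩
          just (u₀ ∷ t)              ≡⟨ cong just (sym head) ⟩
          just (s ∷ʳ u)              ∎) }
      where
      open Switched sw
      open ≡-Reasoning
      h∷ʳu≡ = trans (cong (_∷ʳ u) h≡h₀++s) (Listₚ.++-assoc h₀ s [ u ])
      t = proj₁ (Reach-head reach')
      head = proj₂ (Reach-head reach')

    phase : ∀ {h x} → Reach ρ″ v h x → Phase h x
    phase start = enter refl start
    phase (stepE {h} {u} {x} reach isE moves) with phase reach
    ... | inj₁ (unswitched , cu≢c , reachρ) =
      enter (suffixFrom-∷ʳ {c} h u unswitched cu≢c)
            (stepE reachρ isE (subst-target (ρ″-before h u unswitched cu≢c) moves))
    ... | inj₂ sw = inj₂ (extend sw (stepE (Switched.reach' sw) isE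
                                      (subst-target (Switched.follows-ρ' sw) moves)))
    phase (stepO {h} {u} reach isO edge) with phase reach
    ... | inj₁ (unswitched , cu≢c , reachρ) =
      enter (suffixFrom-∷ʳ {c} h u unswitched cu≢c) (stepO reachρ isO edge)
    ... | inj₂ sw = inj₂ (extend sw (stepO (Switched.reach' sw) isO edge))

    safe : Safe ρ v → (∀ u → col u ≡ c → Safe ρ' u) → Safe ρ″ v
    safe safeρ safeρ' p play lost = ¬¬-excluded-middle {A = Switches} λ where
        (yes (k , unswitched , colour)) →
          safeρ' (p k) colour (shift k p) (InfPlay-shift {ρ″} {ρ'} k play refl (follows-ρ' k unswitched colour))
                 (Lost-shift p k lost)
        (no never) →
          safeρ p (InfPlay-shift {ρ″} {ρ} 0 play (proj₁ play) (λ i _ → follows-ρ never i)) lost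
      where
      Switches = Σ ℕ λ k → suffixFrom c (hist p k) ≡ nothing × col (p k) ≡ c

      follows-ρ' : ∀ k → suffixFrom c (hist p k) ≡ nothing → col (p k) ≡ c → ∀ i → owner (p (k + i)) ≡ E →
                   ρ″ (hist p (k + i)) (p (k + i)) ≡ ρ' (hist (shift k p) i) (shift k p i)
      follows-ρ' k unswitched colour zero _ rewrite ℕₚ.+-identityʳ k =
        ρ″-switch (hist p k) (p k) unswitched colour
      follows-ρ' k unswitched colour (suc i) _ = ρ″-after (hist p (k + suc i)) (p (k + suc i)) (begin
        suffixFrom c (hist p (k + suc i))                   ≡⟨ cong (suffixFrom c) (hist-+ p k (suc i)) ⟩
        suffixFrom c (hist p k ++ hist (shift k p) (suc i)) ≡⟨ suffixFrom-++ {c} (hist p k) _ unswitched ⟩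
        suffixFrom c (hist (shift k p) (suc i))             ≡⟨ suffixFrom-∷ {c} (p (k + 0)) _ colour' ⟩
        just (hist (shift k p) (suc i))                     ∎)
        where
        open ≡-Reasoning
        colour' : col (p (k + 0)) ≡ c
        colour' = subst (λ j → col (p j) ≡ c) (sym (ℕₚ.+-identityʳ k)) colour

      unswitched : ¬ Switches → ∀ i → suffixFrom c (hist p i) ≡ nothing × ¬ col (p i) ≡ c
      unswitched never zero    = refl , λ colour → never (0 , refl , colour)
      unswitched never (suc i) = unswitched' , λ colour → never (suc i , unswitched' , colour)
        where
        unswitched' = trans (cong (suffixFrom c) (hist-suc p i))
                            (uncurry (suffixFrom-∷ʳ {c} (hist p i) (p i)) (unswitched never i))

      follows-ρ : ¬ Switches → ∀ i → ρ″ (hist p i) (p i) ≡ ρ (hist p i) (p i)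
      follows-ρ never i = uncurry (ρ″-before (hist p i) (p i)) (unswitched never i)

    module _ {P : Enforcement nE nO} {Q : V → Enforcement nE nO} (c-isO : colOwner c ≡ O)
             (enfP : IsEnf ρ v P) (enfQ : ∀ u → col u ≡ c → IsEnf ρ' u (Q u)) where

      U : Enforcement nE nO
      U = UnionList (map Q (colorClass c))

      Q⊑U : ∀ {u} → col u ≡ c → Q u ⊑ U
      Q⊑U {u} cu≡c =
        ∈⇒⊑-UnionList (∈ₚ.∈-map⁺ Q (∈ₚ.∈-filter⁺ (λ w → col w ≟C c) (∈ₚ.∈-allFin u) cu≡c))

      lowerBound : LowerBound ρ″ v (Merge P c U)
      lowerBound {x} (h , reach , stops , refl) with phase reach
      ... | inj₁ (unswitched , cx≢c , reachρ) =
        let s , Px≡s , s≼r = IsEnf⇒LowerBound enfP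
                               (h , reachρ , (λ isE → trans (sym (ρ″-before h x unswitched cx≢c)) (stops isE)) , refl)
            t , Mx≡t , t≼s = Merge-upper P c U cx≢c s Px≡s
        in t , Mx≡t , ≼-trans t≼s s≼r
      ... | inj₂ sw =
        let q , Qx≡q , q≼ = IsEnf⇒LowerBound (enfQ u₀ colour₀)
                              (s , reach' , (λ isE → trans (sym follows-ρ') (stops isE)) , refl)
            q' , Ux≡q' , q'≼q = Q⊑U colour₀ (col x) q Qx≡q
            pc , Pc≡pc , pc≼ = IsEnf⇒LowerBound enfP
                                 (h₀ , reach₀ , (λ isE → case trans (sym isE) u₀-isO of λ ()) , refl)
        in subst (λ r → Σ ℕ λ t → Merge P c U (col x) ≡ just t × t ≼ r) (sym MaxRank≡)
             (Merge-lifted-bound P c U {m = MaxRank (h₀ ∷ʳ u₀)} {n = MaxRank (s ∷ʳ x)}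
                (subst (λ a → P a ≡ just pc) colour₀ Pc≡pc) pc≼ Ux≡q' (≼-trans q'≼q q≼))
        where
        open Switched sw
        u₀-isO : owner u₀ ≡ O
        u₀-isO = trans (sym (playerAware u₀)) (trans (cong colOwner colour₀) c-isO)
        MaxRank≡ : MaxRank (h ∷ʳ x) ≡ MaxRank (h₀ ∷ʳ u₀) ⊔ MaxRank (s ∷ʳ x)
        MaxRank≡ = trans (cong (λ l → MaxRank (l ∷ʳ x)) h≡h₀++s)
                         (MaxRank-join h₀ u₀ s x (proj₂ (Reach-head reach')))

      bound : ∀ R → IsEnf ρ″ v R → R ⊑ Merge P c U
      bound R enfR a r Ra with IsEnf⇒Attained enfR Ra
      ... | x , refl , cand = lowerBound cand

  module RedirectStop (cE : Fin nE) (v w : V) (e : ∀ u → col u ≡ inj₁ cE → Edge u w) (ρ ρ' : Strategy) where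

    c : Color nE nO
    c = inj₁ cE

    ρ″ : Strategy
    ρ″ = redirectStop c w e ρ ρ'

    stops : List V → V → Bool
    stops = stopsAt c ρ

    redirected : List V → Maybe (List V)
    redirected = findStop c ρ []

    redirected-∷ʳ-continue : ∀ h u → redirected h ≡ nothing → stops h u ≡ false →
                             redirected (h ∷ʳ u) ≡ nothing
    redirected-∷ʳ-continue h u eq stops≡ rewrite findStop-++-nothing [] h [ u ] eq | stops≡ = refl

    redirected-after-stop : ∀ h u t → redirected h ≡ nothing → stops h u ≡ true →
                            redirected ((h ∷ʳ u) ++ t) ≡ just t
    redirected-after-stop h u t eq stops≡
      rewrite Listₚ.++-assoc h [ u ] t | findStop-++-nothing [] h (u ∷ t) eq | stops≡ = refl

    redirected-∷ʳ-stop : ∀ h u → redirected h ≡ nothing → stops h u ≡ true → redirected (h ∷ʳ u) ≡ just []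
    redirected-∷ʳ-stop h u eq stops≡ =
      subst (λ l → redirected l ≡ just []) (Listₚ.++-identityʳ (h ∷ʳ u)) (redirected-after-stop h u [] eq stops≡)

    redirected-∷ʳ-after : ∀ h u {s} → redirected h ≡ just s → redirected (h ∷ʳ u) ≡ just (s ∷ʳ u)
    redirected-∷ʳ-after h u = findStop-++-just [] h [ u ]

    ρ″-before : ∀ h u → redirected h ≡ nothing → stops h u ≡ false → ρ″ h u ≡ ρ h u
    ρ″-before h u eq stops≡ with findStop c ρ [] h
    ρ″-before h u refl stops≡ | nothing with col u ≟C c | ρ h u
    ... | yes _ | go _ _ = refl
    ... | no _  | _      = refl

    ρ″-redirect : ∀ h u → redirected h ≡ nothing → stops h u ≡ true → target (ρ″ h u) ≡ just w
    ρ″-redirect h u eq stops≡ with findStop c ρ [] h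
    ρ″-redirect h u refl stops≡ | nothing with col u ≟C c | ρ h u
    ... | yes _ | stop = refl

    ρ″-after : ∀ h {s} u → redirected h ≡ just s → ρ″ h u ≡ ρ' s u
    ρ″-after h u eq with findStop c ρ [] h
    ρ″-after h u refl | just s = refl

    StopCandidate : ℕ → Set
    StopCandidate m = Σ V λ u → col u ≡ c × Cand ρ v u m

    record Redirected (h : List V) (x : V) : Set where
      field
        s             : List V
        redirected≡   : redirected h ≡ just s
        reach'        : Reach ρ' w s x
        m             : ℕ
        stopCandidate : StopCandidate m
        MaxRank≡      : MaxRank (h ∷ʳ x) ≡ m ⊔ MaxRank (s ∷ʳ x)

    Phase : List V → V → Set
    Phase h x = (redirected h ≡ nothing × Reach ρ v h x) ⊎ Redirected h x

    extend : ∀ {h u x} → (rd : Redirected h u) → Reach ρ' w (Redirected.s rd ∷ʳ u) x → Redirected (h ∷ʳ u) x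
    extend {h} {u} {x} rd reach = record
      { s = s ∷ʳ u ; redirected≡ = redirected-∷ʳ-after h u redirected≡ ; reach' = reach ; m = m
      ; stopCandidate = stopCandidate
      ; MaxRank≡ = MaxRank-∷ʳ-⊔ (h ∷ʳ u) (s ∷ʳ u) x MaxRank≡ }
      where open Redirected rd

    phase : ∀ {h x} → Reach ρ″ v h x → Phase h x
    phase start = inj₁ (refl , start)
    phase (stepE {h} {u} {x} reach isE moves) with phase reach
    ... | inj₂ rd = inj₂ (extend rd (stepE (Redirected.reach' rd) isE
                                      (subst-target (ρ″-after h u (Redirected.redirected≡ rd)) moves)))
    ... | inj₁ (unredirected , reachρ) with stops h u in stops≡
    ...   | false = inj₁ (redirected-∷ʳ-continue h u unredirected stops≡ ,
                          stepE reachρ isE (subst-target (ρ″-before h u unredirected stops≡) moves))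
    ...   | true with trans (sym moves) (ρ″-redirect h u unredirected stops≡)
    ...     | refl = inj₂ record
      { s = [] ; redirected≡ = redirected-∷ʳ-stop h u unredirected stops≡ ; reach' = start
      ; m = MaxRank (h ∷ʳ u) ; MaxRank≡ = MaxRank-++ (h ∷ʳ u) [ w ]
      ; stopCandidate = u , colour , h , reachρ , (λ _ → ρ≡stop) , refl }
      where open Σ (stopsAt-true⁻ ρ h stops≡) renaming (proj₁ to colour; proj₂ to ρ≡stop)
    phase (stepO {h} {u} reach isO edge) with phase reach
    ... | inj₂ rd = inj₂ (extend rd (stepO (Redirected.reach' rd) isO edge))
    ... | inj₁ (unredirected , reachρ) =
      inj₁ (redirected-∷ʳ-continue h u unredirected (stopsAt-O ρ h isO) , stepO reachρ isO edge)

    Reach-ρ⇒ρ″ : ∀ {h x} → Reach ρ v h x → redirected h ≡ nothing × Reach ρ″ v h x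
    Reach-ρ⇒ρ″ start = refl , start
    Reach-ρ⇒ρ″ (stepE {h} {u} {x} reach isE moves) with Reach-ρ⇒ρ″ reach
    ... | unredirected , reach″ =
      redirected-∷ʳ-continue h u unredirected (stopsAt-move ρ h moves) ,
      stepE reach″ isE (subst-target (sym (ρ″-before h u unredirected (stopsAt-move ρ h moves))) moves)
    Reach-ρ⇒ρ″ (stepO {h} {u} reach isO edge) with Reach-ρ⇒ρ″ reach
    ... | unredirected , reach″ =
      redirected-∷ʳ-continue h u unredirected (stopsAt-O ρ h isO) , stepO reach″ isO edge

    Reach-ρ'⇒ρ″ : ∀ {h₀ u₀ h₁ x} → redirected h₀ ≡ nothing → Reach ρ″ v h₀ u₀ → stops h₀ u₀ ≡ true →
                  Reach ρ' w h₁ x → Reach ρ″ v ((h₀ ∷ʳ u₀) ++ h₁) x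
    Reach-ρ'⇒ρ″ {h₀} {u₀} unredirected reach₀ stops≡ start =
      subst (λ l → Reach ρ″ v l w) (sym (Listₚ.++-identityʳ (h₀ ∷ʳ u₀)))
        (stepE reach₀ (colourE⇒ownerE (proj₁ (stopsAt-true⁻ ρ h₀ stops≡)))
               (ρ″-redirect h₀ u₀ unredirected stops≡))
    Reach-ρ'⇒ρ″ {h₀} {u₀} unredirected reach₀ stops≡ (stepE {h₁} {u} {x} reach isE moves) =
      subst (λ l → Reach ρ″ v l x) (Listₚ.++-assoc (h₀ ∷ʳ u₀) h₁ [ u ])
        (stepE (Reach-ρ'⇒ρ″ unredirected reach₀ stops≡ reach) isE
          (subst-target (sym (ρ″-after ((h₀ ∷ʳ u₀) ++ h₁) u
                                        (redirected-after-stop h₀ u₀ h₁ unredirected stops≡))) moves))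
    Reach-ρ'⇒ρ″ {h₀} {u₀} unredirected reach₀ stops≡ (stepO {h₁} {u} {x} reach isO edge) =
      subst (λ l → Reach ρ″ v l x) (Listₚ.++-assoc (h₀ ∷ʳ u₀) h₁ [ u ])
        (stepO (Reach-ρ'⇒ρ″ unredirected reach₀ stops≡ reach) isO edge)

    stop-before⇒ρ-stop : ∀ {h x} → redirected h ≡ nothing → ρ″ h x ≡ stop → ρ h x ≡ stop × ¬ col x ≡ c
    stop-before⇒ρ-stop {h} {x} unredirected ρ″≡stop with stops h x in stops≡
    ... | false = ρ≡stop , λ cx≡c → case trans (sym (stopsAt-true ρ h cx≡c ρ≡stop)) stops≡ of λ ()
      where ρ≡stop = trans (sym (ρ″-before h x unredirected stops≡)) ρ″≡stop
    ... | true = case trans (sym (ρ″-redirect h x unredirected stops≡)) (cong target ρ″≡stop) of λ ()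

    Cand-ρ⇒ρ″ : ∀ {x t} → ¬ col x ≡ c → Cand ρ v x t → Cand ρ″ v x t
    Cand-ρ⇒ρ″ {x} cx≢c (h , reach , stopsρ , MaxRank≡) with Reach-ρ⇒ρ″ reach
    ... | unredirected , reach″ =
      h , reach″ , (λ isE → trans (ρ″-before h x unredirected (stopsAt-≢ ρ h cx≢c)) (stopsρ isE)) , MaxRank≡

    Cand-before⇒ρ : ∀ {h x} → redirected h ≡ nothing → Reach ρ v h x → (owner x ≡ E → ρ″ h x ≡ stop) →
                    Cand ρ v x (MaxRank (h ∷ʳ x)) × ¬ col x ≡ c
    Cand-before⇒ρ {h} {x} unredirected reach stops″ with owner x in ownerx
    ... | O = (h , reach , (λ ()) , refl) , ownerO⇒colour≢E ownerx
    ... | E = (h , reach , (λ _ → proj₁ ρ-stop) , refl) , proj₂ ρ-stop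
      where ρ-stop = stop-before⇒ρ-stop unredirected (stops″ refl)

    Cand-join : ∀ {u₀ x m n} → col u₀ ≡ c → Cand ρ v u₀ m → Cand ρ' w x n → Cand ρ″ v x (n ⊔ m)
    Cand-join {u₀} {x} cu₀≡c (h₀ , reach₀ , stops₀ , refl) (h₁ , reach₁ , stops₁ , refl) =
      (h₀ ∷ʳ u₀) ++ h₁ , Reach-ρ'⇒ρ″ unredirected reach₀″ u₀-stops reach₁ ,
      (λ isE → trans (ρ″-after ((h₀ ∷ʳ u₀) ++ h₁) x (redirected-after-stop h₀ u₀ h₁ unredirected u₀-stops))
                     (stops₁ isE)) ,
      (begin
        MaxRank (((h₀ ∷ʳ u₀) ++ h₁) ∷ʳ x)        ≡⟨ cong MaxRank (Listₚ.++-assoc (h₀ ∷ʳ u₀) h₁ [ x ]) ⟩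
        MaxRank ((h₀ ∷ʳ u₀) ++ (h₁ ∷ʳ x))        ≡⟨ MaxRank-++ (h₀ ∷ʳ u₀) (h₁ ∷ʳ x) ⟩
        MaxRank (h₀ ∷ʳ u₀) ⊔ MaxRank (h₁ ∷ʳ x)   ≡⟨ ℕₚ.⊔-comm (MaxRank (h₀ ∷ʳ u₀)) _ ⟩
        MaxRank (h₁ ∷ʳ x) ⊔ MaxRank (h₀ ∷ʳ u₀)   ∎)
      where
      open ≡-Reasoning
      unredirected = proj₁ (Reach-ρ⇒ρ″ reach₀)
      reach₀″ = proj₂ (Reach-ρ⇒ρ″ reach₀)
      u₀-stops = stopsAt-true ρ h₀ cu₀≡c (stops₀ (colourE⇒ownerE cu₀≡c))

    module _ {P Q : Enforcement nE nO} (enfP : IsEnf ρ v P) (enfQ : IsEnf ρ' w Q) where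

      lowerBound : LowerBound ρ″ v (Merge P c Q)
      lowerBound {x} (h , reach , stops″ , refl) with phase reach
      ... | inj₁ (unredirected , reachρ) =
        let cand , cx≢c = Cand-before⇒ρ unredirected reachρ stops″
            s , Px≡s , s≼r = IsEnf⇒LowerBound enfP cand
            t , Mx≡t , t≼s = Merge-upper P c Q cx≢c s Px≡s
        in t , Mx≡t , ≼-trans t≼s s≼r
      ... | inj₂ rd =
        let q , Qx≡q , q≼ = IsEnf⇒LowerBound enfQ
                              (s , reach' , (λ isE → trans (sym (ρ″-after h x redirected≡)) (stops″ isE)) , refl)
            u₀ , cu₀≡c , cand₀ = stopCandidate
            pc , Pc≡pc , pc≼m = IsEnf⇒LowerBound enfP cand₀
        in subst (λ r → Σ ℕ λ t → Merge P c Q (col x) ≡ just t × t ≼ r) (sym MaxRank≡)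
             (Merge-lifted-bound P c Q {m = m} {n = MaxRank (s ∷ʳ x)}
                (subst (λ a → P a ≡ just pc) cu₀≡c Pc≡pc) pc≼m Qx≡q q≼)
        where open Redirected rd

      attained : Attained ρ″ v (Merge P c Q)
      attained {a} {t} Ma≡t = by-cases (P c) refl
        where
        from-P : ¬ a ≡ c → P a ≡ just t → Σ V λ x → col x ≡ a × Cand ρ″ v x t
        from-P a≢c Pa≡t with IsEnf⇒Attained enfP Pa≡t
        ... | x , refl , cand = x , refl , Cand-ρ⇒ρ″ a≢c cand

        by-cases : ∀ mp → P c ≡ mp → Σ V λ x → col x ≡ a × Cand ρ″ v x t
        by-cases nothing Pc≡nothing =
          from-P (λ { refl → case trans (sym Pa≡t) Pc≡nothing of λ () }) Pa≡t
          where Pa≡t = trans (sym (cong-app (Merge-undefined P c Q Pc≡nothing) a)) Ma≡t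
        by-cases (just pc) Pc≡pc
          with Union-sel (undefAt P c) (Lift Q pc) (trans (sym (cong-app (Merge-defined P c Q Pc≡pc) a)) Ma≡t)
        ... | inj₁ undefAt≡t = uncurry from-P (undefAt-just⁻ P undefAt≡t)
        ... | inj₂ Lift≡t with Lift-just⁻ Q pc Lift≡t
        ...   | q , Qa≡q , refl with IsEnf⇒Attained enfQ Qa≡q | IsEnf⇒Attained enfP Pc≡pc
        ...     | x , cx≡a , cand | u₀ , cu₀≡c , cand₀ = x , cx≡a , Cand-join cu₀≡c cand₀ cand

      enf : IsEnf ρ″ v (Merge P c Q)
      enf = IsEnf-intro lowerBound attained

    safe : Safe ρ v → Safe ρ' w → Safe ρ″ v
    safe safeρ safeρ' p play lost = ¬¬-excluded-middle {A = Redirects} λ where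
        (yes (k , unredirected , stops≡)) →
          safeρ' (shift (suc k) p) (InfPlay-shift {ρ″} {ρ'} (suc k) play (p[1+k]≡w k unredirected stops≡)
                                      (λ i _ → follows-ρ' k unredirected stops≡ i))
                 (Lost-shift p (suc k) lost)
        (no never) →
          safeρ p (InfPlay-shift {ρ″} {ρ} 0 play (proj₁ play)
                     (λ i _ → uncurry (ρ″-before (hist p i) (p i)) (unredirected never i)))
                lost
      where
      Redirects = Σ ℕ λ k → redirected (hist p k) ≡ nothing × stops (hist p k) (p k) ≡ true

      p[1+k]≡w : ∀ k → redirected (hist p k) ≡ nothing → stops (hist p k) (p k) ≡ true → p (suc k) ≡ w
      p[1+k]≡w k unredirected stops≡
        with trans (sym (proj₁ (proj₂ play k) (colourE⇒ownerE (proj₁ (stopsAt-true⁻ ρ (hist p k) stops≡)))))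
                   (ρ″-redirect (hist p k) (p k) unredirected stops≡)
      ... | refl = refl

      follows-ρ' : ∀ k → redirected (hist p k) ≡ nothing → stops (hist p k) (p k) ≡ true → ∀ i →
                   ρ″ (hist p (suc k + i)) (p (suc k + i)) ≡ ρ' (hist (shift (suc k) p) i) (shift (suc k) p i)
      follows-ρ' k unredirected stops≡ i = ρ″-after (hist p (suc k + i)) (p (suc k + i)) (begin
        redirected (hist p (suc k + i))      ≡⟨ cong redirected (hist-+ p (suc k) i) ⟩
        redirected (hist p (suc k) ++ t)     ≡⟨ cong (λ l → redirected (l ++ t)) (hist-suc p k) ⟩
        redirected ((hist p k ∷ʳ p k) ++ t)  ≡⟨ redirected-after-stop (hist p k) (p k) t unredirected stops≡ ⟩
        just t                               ∎)
        where
        open ≡-Reasoning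
        t = hist (shift (suc k) p) i

      continues : ¬ Redirects → ∀ i → redirected (hist p i) ≡ nothing → stops (hist p i) (p i) ≡ false
      continues never i unredirected = ¬-not λ stops≡ → never (i , unredirected , stops≡)

      unredirected : ¬ Redirects → ∀ i → redirected (hist p i) ≡ nothing × stops (hist p i) (p i) ≡ false
      unredirected never zero    = refl , continues never 0 refl
      unredirected never (suc i) = unredirected' , continues never (suc i) unredirected'
        where
        unredirected' = trans (cong redirected (hist-suc p i))
                              (uncurry (redirected-∷ʳ-continue (hist p i) (p i)) (unredirected never i))

  module LoopStop (cE : Fin nE) (v : V) (e : ∀ u → col u ≡ inj₁ cE → Edge u v) (ρ : Strategy) where

    c : Color nE nO
    c = inj₁ cE

    ρ″ : Strategy
    ρ″ = loopStop c v e ρ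

    stops : List V → V → Bool
    stops = stopsAt c ρ

    -- the part of the history since the last return to v
    round : List V → List V
    round = segment c ρ []

    round-∷ʳ-continue : ∀ h u → stops (round h) u ≡ false → round (h ∷ʳ u) ≡ round h ∷ʳ u
    round-∷ʳ-continue h u stops≡ =
      trans (segment-++ [] h [ u ]) (cong (λ b → if b then [] else round h ∷ʳ u) stops≡)

    round-∷ʳ-restart : ∀ h u → stops (round h) u ≡ true → round (h ∷ʳ u) ≡ []
    round-∷ʳ-restart h u stops≡ =
      trans (segment-++ [] h [ u ]) (cong (λ b → if b then [] else round h ∷ʳ u) stops≡)

    ρ″-continue : ∀ h u → stops (round h) u ≡ false → ρ″ h u ≡ ρ (round h) u
    ρ″-continue h u stops≡ with col u ≟C c | ρ (round h) u
    ... | yes _ | go _ _ = refl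
    ... | no _  | _      = refl

    ρ″-restart : ∀ h u → stops (round h) u ≡ true → target (ρ″ h u) ≡ just v
    ρ″-restart h u stops≡ with col u ≟C c | ρ (round h) u
    ... | yes _ | stop = refl

    ρ″-cong : ∀ h h' u → round h ≡ round h' → ρ″ h u ≡ ρ″ h' u
    ρ″-cong h h' u eq with segment c ρ [] h | segment c ρ [] h' | eq
    ... | a | .a | refl with col u ≟C c | ρ a u
    ...   | yes _ | stop   = refl
    ...   | yes _ | go _ _ = refl
    ...   | no _  | _      = refl

    Reach-ρ⇒ρ″ : ∀ {h x} → Reach ρ v h x → round h ≡ h × Reach ρ″ v h x
    Reach-ρ⇒ρ″ start = refl , start
    Reach-ρ⇒ρ″ (stepE {h} {u} {x} reach isE moves) with Reach-ρ⇒ρ″ reach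
    ... | round≡h , reach″ =
      trans (round-∷ʳ-continue h u continues) (cong (_∷ʳ u) round≡h) ,
      stepE reach″ isE (subst-target (sym (trans (ρ″-continue h u continues) (cong (λ l → ρ l u) round≡h))) moves)
      where continues = subst (λ l → stops l u ≡ false) (sym round≡h) (stopsAt-move ρ h moves)
    Reach-ρ⇒ρ″ (stepO {h} {u} reach isO edge) with Reach-ρ⇒ρ″ reach
    ... | round≡h , reach″ =
      trans (round-∷ʳ-continue h u (stopsAt-O ρ (round h) isO)) (cong (_∷ʳ u) round≡h) , stepO reach″ isO edge

    ρ″-stop⇒Cand : ∀ h {x} → Reach ρ v (round h) x → (owner x ≡ E → ρ″ h x ≡ stop) →
                   Cand ρ v x (MaxRank (round h ∷ʳ x)) × ¬ col x ≡ c
    ρ″-stop⇒Cand h {x} reach stops″ with owner x in ownerx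
    ... | O = (round h , reach , (λ ()) , refl) , ownerO⇒colour≢E ownerx
    ... | E with stops (round h) x in stops≡
    ...   | true  = case trans (sym (ρ″-restart h x stops≡)) (cong target (stops″ refl)) of λ ()
    ...   | false = (round h , reach , (λ _ → ρ≡stop) , refl) ,
                    λ cx≡c → case trans (sym (stopsAt-true ρ (round h) cx≡c ρ≡stop)) stops≡ of λ ()
      where ρ≡stop = trans (sym (ρ″-continue h x stops≡)) (stops″ refl)

    module _ {P L : Enforcement nE nO} (enfP : IsEnf ρ v P) (loop : Loop P c ≡ just L) where

      stop-even : ∀ {u m} → col u ≡ c → Cand ρ v u m → isEven m ≡ true
      stop-even {m = m} cu≡c cand with IsEnf⇒LowerBound enfP cand
      ... | pc , Pcu≡pc , pc≼m =
        proj₁ (even≼⇒ {pc} {m} (Loop-even P cE loop (subst (λ a → P a ≡ just pc) cu≡c Pcu≡pc)) pc≼m)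

      -- t is the maximal rank of the completed rounds
      Rounds : List V → V → Set
      Rounds h x = Reach ρ v (round h) x ×
                   Σ ℕ λ t → isEven t ≡ true × MaxRank (h ∷ʳ x) ≡ t ⊔ MaxRank (round h ∷ʳ x)

      closing-round-even : ∀ h {u} → Rounds h u → stops (round h) u ≡ true → isEven (MaxRank (h ∷ʳ u)) ≡ true
      closing-round-even h (reach , t , t-even , MaxRank≡) stops≡ =
        subst (λ m → isEven m ≡ true) (sym MaxRank≡)
          (⊔-even {t} t-even (stop-even colour (round h , reach , (λ _ → ρ≡stop) , refl)))
        where open Σ (stopsAt-true⁻ ρ (round h) stops≡) renaming (proj₁ to colour; proj₂ to ρ≡stop)

      continue : ∀ h u {x} → Rounds h u → stops (round h) u ≡ false → Reach ρ v (round h ∷ʳ u) x →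
                 Rounds (h ∷ʳ u) x
      continue h u {x} (_ , t , t-even , MaxRank≡) stops≡ reach =
        subst (λ l → Reach ρ v l x) round≡ reach , t , t-even ,
        trans (MaxRank-∷ʳ-⊔ (h ∷ʳ u) (round h ∷ʳ u) x MaxRank≡) (cong (λ l → t ⊔ MaxRank (l ∷ʳ x)) round≡)
        where round≡ = sym (round-∷ʳ-continue h u stops≡)

      rounds : ∀ {h x} → Reach ρ″ v h x → Rounds h x
      rounds start = start , 0 , refl , refl
      rounds (stepE {h} {u} {x} reach isE moves) with rounds reach | stops (round h) u in stops≡
      ... | rs | false = continue h u rs stops≡
                           (stepE (proj₁ rs) isE (subst-target (ρ″-continue h u stops≡) moves))
      ... | rs | true with trans (sym moves) (ρ″-restart h u stops≡)
      ...   | refl = subst (λ l → Reach ρ v l v) round≡[] start ,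
                     MaxRank (h ∷ʳ u) , closing-round-even h rs stops≡ ,
                     trans (MaxRank-++ (h ∷ʳ u) [ v ]) (cong (λ l → MaxRank (h ∷ʳ u) ⊔ MaxRank (l ∷ʳ v)) round≡[])
        where round≡[] = sym (round-∷ʳ-restart h u stops≡)
      rounds (stepO {h} {u} reach isO edge) with rounds reach
      ... | rs = continue h u rs (stopsAt-O ρ (round h) isO) (stepO (proj₁ rs) isO edge)

      lowerBound : LowerBound ρ″ v L
      lowerBound {x} (h , reach , stops″ , refl) with rounds reach
      ... | reachρ , t , t-even , MaxRank≡ with ρ″-stop⇒Cand h reachρ stops″
      ...   | cand , cx≢c with IsEnf⇒LowerBound enfP cand
      ...     | s , Px≡s , s≼ =
        s , trans (Loop-≢ P cE loop cx≢c) Px≡s ,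
        ≼-trans s≼ (subst (MaxRank (round h ∷ʳ x) ≼_) (sym MaxRank≡)
                          (≼even⊔ (MaxRank (round h ∷ʳ x)) {t} t-even))

      defined⇒≢c : ∀ {a s} → L a ≡ just s → ¬ a ≡ c
      defined⇒≢c La≡s refl = case trans (sym La≡s) (Loop-self P cE loop) of λ ()

      attained : Attained ρ″ v L
      attained {a} {s} La≡s
        with IsEnf⇒Attained enfP (trans (sym (Loop-≢ P cE loop (defined⇒≢c La≡s))) La≡s)
      ... | x , cx≡a , (h , reach , stopsρ , MaxRank≡) with Reach-ρ⇒ρ″ reach
      ...   | round≡h , reach″ =
        x , cx≡a , h , reach″ ,
        (λ isE → trans (trans (ρ″-continue h x continues) (cong (λ l → ρ l x) round≡h)) (stopsρ isE)) , MaxRank≡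
        where continues = stopsAt-≢ ρ (round h) (λ cx≡c → defined⇒≢c La≡s (trans (sym cx≡a) cx≡c))

      enf : IsEnf ρ″ v L
      enf = IsEnf-intro lowerBound attained

      Restarts : (ℕ → V) → ℕ → Bool
      Restarts q j = stops (round (hist q j)) (q j)

      round-after-restart : ∀ q j → Restarts q j ≡ true → ∀ i →
                            round (hist q (suc j + i)) ≡ round (hist (shift (suc j) q) i)
      round-after-restart q j restart i = begin
        round (hist q (suc j + i))                       ≡⟨ cong round (hist-+ q (suc j) i) ⟩
        round (hist q (suc j) ++ t)                      ≡⟨ segment-++ [] (hist q (suc j)) t ⟩
        segment c ρ (round (hist q (suc j))) t           ≡⟨ cong (λ l → segment c ρ (round l) t) (hist-suc q j) ⟩
        segment c ρ (round (hist q j ∷ʳ q j)) t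
          ≡⟨ cong (λ l → segment c ρ l t) (round-∷ʳ-restart (hist q j) (q j) restart) ⟩
        round t                                          ∎
        where
        open ≡-Reasoning
        t = hist (shift (suc j) q) i

      Restarts-shift : ∀ q j → Restarts q j ≡ true → ∀ i →
                       Restarts (shift (suc j) q) i ≡ Restarts q (suc j + i)
      Restarts-shift q j restart i = cong (λ l → stops l (q (suc j + i))) (sym (round-after-restart q j restart i))

      InfPlay-restart : ∀ {q} j → InfPlay ρ″ v q → Restarts q j ≡ true → InfPlay ρ″ v (shift (suc j) q)
      InfPlay-restart {q} j play restart =
        InfPlay-shift {ρ″} {ρ″} (suc j) play returns
          (λ i _ → ρ″-cong (hist q (suc j + i)) (hist (shift (suc j) q) i) (q (suc j + i))
                           (round-after-restart q j restart i))
        where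
        isE = colourE⇒ownerE (proj₁ (stopsAt-true⁻ ρ (round (hist q j)) restart))
        returns : q (suc j) ≡ v
        returns with trans (sym (proj₁ (proj₂ play j) isE)) (ρ″-restart (hist q j) (q j) restart)
        ... | refl = refl

      InfPlay-unrestarted : ∀ {q} → InfPlay ρ″ v q → (∀ i → Restarts q i ≡ false) → InfPlay ρ v q
      InfPlay-unrestarted {q} play never =
        InfPlay-shift {ρ″} {ρ} 0 play (proj₁ play)
          (λ i _ → trans (ρ″-continue (hist q i) (q i) (never i)) (cong (λ l → ρ l (q i)) (round≡hist i)))
        where
        round≡hist : ∀ i → round (hist q i) ≡ hist q i
        round≡hist zero    = refl
        round≡hist (suc i) = begin
          round (hist q (suc i))        ≡⟨ cong round (hist-suc q i) ⟩
          round (hist q i ∷ʳ q i)       ≡⟨ round-∷ʳ-continue (hist q i) (q i) (never i) ⟩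
          round (hist q i) ∷ʳ q i       ≡⟨ cong (_∷ʳ q i) (round≡hist i) ⟩
          hist q i ∷ʳ q i               ≡⟨ sym (hist-suc q i) ⟩
          hist q (suc i)                ∎
          where open ≡-Reasoning

      -- The history up to a return to v consists of closed rounds, so its maximal rank is even.
      odd-maximum-never-closes : ∀ {q r} → InfPlay ρ″ v q → (∀ k → rank (q k) ≤ r) → isEven r ≡ false →
                                 ∀ {a b} → a ≤ b → rank (q a) ≡ r → Restarts q b ≡ true → ⊥
      odd-maximum-never-closes {q} {r} play bounded r-odd {a} {b} a≤b rank≡r restart =
        case trans (sym (subst (λ m → isEven m ≡ true) MaxRank≡r even)) r-odd of λ ()
        where
        even : isEven (MaxRank (hist q b ∷ʳ q b)) ≡ true
        even = closing-round-even (hist q b) (rounds (InfPlay⇒Reach play b)) restart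
        MaxRank≡r : MaxRank (hist q b ∷ʳ q b) ≡ r
        MaxRank≡r = ℕₚ.≤-antisym
          (subst (_≤ r) (cong MaxRank (hist-suc q b)) (MaxRank-hist≤ q (suc b) λ k _ → bounded k))
          (subst₂ _≤_ rank≡r (cong MaxRank (hist-suc q b)) (rank≤MaxRank-hist q (s≤s a≤b)))

      safe : Safe ρ v → Safe ρ″ v
      safe safeρ p play lost@(r , r-odd , often , N , bounded) =
        ¬¬-excluded-middle {A = FinitelyManyRestarts} λ where
          (yes (M , none)) → case last-true (Restarts p) M none of λ where
            (inj₁ never) → safeρ p (InfPlay-unrestarted play never) lost
            (inj₂ (j , restart , none-after)) →
              safeρ (shift (suc j) p)
                    (InfPlay-unrestarted (InfPlay-restart j play restart)
                       (λ i → trans (Restarts-shift p j restart i) (none-after (suc j + i) (s≤s (ℕₚ.m≤m+n j i)))))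
                    (Lost-shift p (suc j) lost)
          (no infinitely) →
            restart-beyond infinitely N λ (j , N≤j , restart) →
            let (i , 1+j≤i , rank≡r) = often (suc j) in
            restart-beyond infinitely i λ (j' , i≤j' , restart') →
            revisit j N≤j restart i 1+j≤i rank≡r j' i≤j' restart'
        where
        FinitelyManyRestarts = Σ ℕ λ M → ∀ j → M ≤ j → Restarts p j ≡ false

        restart-beyond : ¬ FinitelyManyRestarts → ∀ M → DoubleNegation (Σ ℕ λ j → M ≤ j × Restarts p j ≡ true)
        restart-beyond infinitely M none =
          infinitely (M , λ j M≤j → ¬-not λ restart → none (j , M≤j , restart))

        -- From a restart beyond N on, every rank is at most r; r is visited at i and a round closes at j'.
        revisit : ∀ j → N ≤ j → Restarts p j ≡ true → ∀ i → suc j ≤ i → rank (p i) ≡ r →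
                  ∀ j' → i ≤ j' → Restarts p j' ≡ true → ⊥
        revisit j N≤j restart i 1+j≤i rank≡r j' i≤j' restart'
          with ℕₚ.m≤n⇒∃[o]m+o≡n 1+j≤i | ℕₚ.m≤n⇒∃[o]m+o≡n (ℕₚ.≤-trans 1+j≤i i≤j')
        ... | a , refl | b , refl =
          odd-maximum-never-closes (InfPlay-restart j play restart)
            (λ k → bounded (suc j + k) (ℕₚ.≤-trans N≤j (ℕₚ.≤-trans (ℕₚ.n≤1+n j) (ℕₚ.m≤m+n (suc j) k))))
            r-odd (ℕₚ.+-cancelˡ-≤ (suc j) a b i≤j') rank≡r (trans (Restarts-shift p j restart b) restart')

lemma18 : (G : StopParityGame) → let open Game G in
    (∀ (P P' Q Q' : Enforcement nE nO) → Bounded P → Bounded P' → Bounded Q → Bounded Q'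
       → P' ⊑ P → Q' ⊑ Q → ∀ c → Merge P' c Q' ⊑ Merge P c Q)
    × (∀ (cO : Fin nO) (v : V) (ρ ρ' : Strategy) (P : Enforcement nE nO)
         (Q : V → Enforcement nE nO)
       → Safe ρ v → (∀ u → col u ≡ inj₂ cO → Safe ρ' u)
       → IsEnf ρ v P → (∀ u → col u ≡ inj₂ cO → IsEnf ρ' u (Q u))
       → Safe (switchOnColor (inj₂ cO) ρ ρ') v
         × (∀ R → IsEnf (switchOnColor (inj₂ cO) ρ ρ') v R
                → R ⊑ Merge P (inj₂ cO) (UnionList (map Q (colorClass (inj₂ cO))))))
    × (∀ (cE : Fin nE) (v w : V) (ρ ρ' : Strategy) (P Q : Enforcement nE nO)
         (e : ∀ u → col u ≡ inj₁ cE → Edge u w)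
       → Safe ρ v → Safe ρ' w → IsEnf ρ v P → IsEnf ρ' w Q
       → Safe (redirectStop (inj₁ cE) w e ρ ρ') v
         × IsEnf (redirectStop (inj₁ cE) w e ρ ρ') v (Merge P (inj₁ cE) Q))
    × (∀ (cE : Fin nE) (v : V) (ρ : Strategy) (P L : Enforcement nE nO)
         (e : ∀ u → col u ≡ inj₁ cE → Edge u v)
       → Safe ρ v → IsEnf ρ v P → Loop P (inj₁ cE) ≡ just L
       → Safe (loopStop (inj₁ cE) v e ρ) v × IsEnf (loopStop (inj₁ cE) v e ρ) v L)
lemma18 G =
  -- the bounds on the values of the enforcements are not needed
  (λ _ _ _ _ _ _ _ _ P'⊑P Q'⊑Q c → Merge-mono P'⊑P Q'⊑Q c) ,
  (λ cO v ρ ρ' _ _ safeρ safeρ' enfP enfQ → let open SwitchOnColor G (inj₂ cO) v ρ ρ' in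
     safe safeρ safeρ' , λ R → bound refl enfP enfQ R) ,
  (λ cE v w ρ ρ' _ _ e safeρ safeρ' enfP enfQ → let open RedirectStop G cE v w e ρ ρ' in
     safe safeρ safeρ' , enf enfP enfQ) ,
  (λ cE v ρ _ _ e safeρ enfP loop → let open LoopStop G cE v e ρ in
     safe enfP loop safeρ , enf enfP loop)
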